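{- Consider the weighted hook walk for a partition $\lambda$ with positive weights $(x_i)_{i\in\mathbb{Z}},(y_j)_{j\in\mathbb{Z}}$. Suppose the walk starts at $(i_1,j_1)$ and is $(i_1,j_1)\to(i_2,j_2)\to\cdots\to(r,s)$, where $(r,s)$ is a corner or an outer corner of $\lambda$, and write $I=\{i_1,i_2,\ldots,r\}$, $J=\{j_1,j_2,\ldots,s\}$ for its vertical and horizontal projections. (a) If $(r,s)$ is a corner of $\lambda$, then the probability that the walk has vertical projection $I$ and horizontal projection $J$, conditional on starting at $(i_1,j_1)$, is \[ \frac {\prod_{i \in I \setminus \{i_1 \}}x_i} {\prod_{i \in I \setminus \{r \}} (x_{i+1}+\cdots + x_{r} + y_{s+1} + \cdots + y_{\lambda_i})} \cdot \frac {\prod_{j \in J \setminus \{j_1\}}y_j} {\prod_{j \in J \setminus \{s\}} (x_{r+1}+\cdots + x_{\lambda'_j} + y_{j+1} + \cdots + y_{s})}. \] (b) If $(r,s)$ is an outer corner of $\lambda$, then this probability is \[ \frac {\prod_{i \in I \setminus \{i_1 \}}x_i} {\prod_{i \in I \setminus \{r \}} (x_{r}+\cdots + x_{i-1} + y_{\lambda_i+1} + \cdots + y_{s-1})} \cdot \frac {\prod_{j \in J \setminus \{j_1\}}y_j} {\prod_{j \in J \setminus \{s\}} (x_{\lambda'_j+1}+\cdots + x_{r-1} + y_{s} + \cdots + y_{j-1})}. \]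
   Context: Let $\lambda=(\lambda_1\ge\cdots\ge\lambda_\ell>0)$ be a partition, $\ell=\ell(\lambda)$, with diagram $[\lambda]=\{(i,j)\in\mathbb{Z}^2:1\le i\le\ell,1\le j\le\lambda_i\}$ ($i$ = row, increasing downward; $j$ = column) and conjugate $\lambda'_j=\max\{i:\lambda_i\ge j\}$. Extend these to all integers: $\lambda_i=\lambda_1$ for $i\le 0$, $\lambda_i=0$ for $i\ge\ell+1$, $\lambda'_j=\ell$ for $j\le 0$, $\lambda'_j=0$ for $j\ge\lambda_1+1$. A corner of $\lambda$ is $(i,j)\in[\lambda]$ with $(i+1,j),(i,j+1)\notin[\lambda]$; an outer corner is $(i,j)\notin[\lambda]$, $i,j\ge1$, with ($i=1$ or $(i-1,j)\in[\lambda]$) and ($j=1$ or $(i,j-1)\in[\lambda]$). Sums $x_a+\cdots+x_b$ with $b<a$ are $0$. Weighted hook walk: fix positive reals $x_i,y_j$ ($i,j\in\mathbb{Z}$) with $\sum_i x_i<\infty$, $\sum_j y_j<\infty$. The starting square $(i,j)\in\mathbb{Z}^2$ is chosen with probability $x_iy_j/((\sum_p x_p)(\sum_q y_q))$. If the current square $(i,j)$ lies in $D=\{(i,j): i\le \ell,\ j\le\lambda_i\}$, the possible moves are to $(i',j)$ with $i<i'\le\lambda'_j$, each with probability proportional to $x_{i'}$, and to $(i,j')$ with $j<j'\le\lambda_i$, each with probability proportional to $y_{j'}$ (normalizing constant $x_{i+1}+\cdots+x_{\lambda'_j}+y_{j+1}+\cdots+y_{\lambda_i}$); the walk stops when no move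 is possible, which happens exactly at the corners of $\lambda$. If the current square lies in $D'=\{(i,j): i\ge1,\ j\ge1,\ j>\lambda_i\}$, the possible moves are to $(i',j)$ with $\lambda'_j<i'<i$, with probability proportional to $x_{i'}$, and to $(i,j')$ with $\lambda_i<j'<j$, with probability proportional to $y_{j'}$; the walk stops when no move is possible, which happens exactly at the outer corners of $\lambda$. (Walks starting outside $D\cup D'$ move right/up or left/down towards and stop at $(\ell+1,0)$ or $(0,\lambda_1+1)$, which are neither corners nor outer corners.) -}

module Defs where

open import Level using (Level; _⊔_) renaming (suc to lsuc)
open import Data.Bool using (Bool; true; false; if_then_else_; not; _∧_)
open import Data.Nat as ℕ using (ℕ; zero; suc)
open import Data.Integer as ℤ using (ℤ; +_; -[1+_]; ∣_∣; _≟_; _≤?_)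
open import Data.Product using (_×_; _,_; proj₁; proj₂)
open import Data.Sum using (_⊎_)
open import Data.List using (List; []; _∷_; map; filter; foldr; upTo; length; concatMap; deduplicate; null)
open import Data.Bool.ListAction using (all; any)
open import Data.List.Relation.Unary.All using (All)
open import Data.List.Relation.Unary.Linked using (Linked)
open import Relation.Nullary using (¬_; Dec; yes; no)
open import Relation.Nullary.Decidable using (⌊_⌋; ¬?)
open import Relation.Binary.PropositionalEquality using (_≡_; _≢_)
open import Relation.Binary.Structures using (IsStrictTotalOrder)
open import Algebra.Bundles using (CommutativeRing)

-- Ordered fields (the weights are positive elements of an ordered
-- field; the reals are the intended instance).  The inverse is a total
-- function, required to be a genuine inverse on nonzero elements.

record OrderedField (c ℓ : Level) : Set (lsuc (c ⊔ ℓ)) where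
  field
    commutativeRing : CommutativeRing c ℓ
  open CommutativeRing commutativeRing public
  field
    _<_       : Carrier → Carrier → Set ℓ
    isSTO     : IsStrictTotalOrder _≈_ _<_
    0<1       : 0# < 1#
    +-mono-<  : ∀ {a b} c → a < b → (a + c) < (b + c)
    *-pos     : ∀ {a b} → 0# < a → 0# < b → 0# < (a * b)
    _⁻¹       : Carrier → Carrier
    ⁻¹-inverse : ∀ a → ¬ (a ≈ 0#) → (a * (a ⁻¹)) ≈ 1#

IsPartition : List ℕ → Set
IsPartition p = (p ≢ []) × All (ℕ._<_ 0) p × Linked ℕ._≥_ p

Sq : Set
Sq = ℤ × ℤ

-- integer range [a, b] (empty if b < a)
rangeZ : ℤ → ℤ → List ℤ
rangeZ a b with a ≤? b
... | yes _ = map (λ k → a ℤ.+ (+ k)) (upTo (suc ∣ b ℤ.- a ∣))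
... | no  _ = []

_==_ : ℤ → ℤ → Bool
a == b = ⌊ a ≟ b ⌋

infix 4 _≤ᵇ_ _==_
_≤ᵇ_ : ℤ → ℤ → Bool
a ≤ᵇ b = ⌊ a ≤? b ⌋

memb : ℤ → List ℤ → Bool
memb a l = any (a ==_) l

sameSet : List ℤ → List ℤ → Bool
sameSet l m = all (λ a → memb a m) l ∧ all (λ a → memb a l) m

dedup : List ℤ → List ℤ
dedup = deduplicate _≟_

remove : ℤ → List ℤ → List ℤ
remove a = filter (λ b → ¬? (b ≟ a))

module Part (p : List ℕ) where

  ℓ : ℕ
  ℓ = length p

  λ₁ : ℕ
  λ₁ = foldr (λ a _ → a) 0 p

  nth : ℕ → List ℕ → ℕ
  nth _ [] = 0
  nth zero (a ∷ _) = a
  nth (suc n) (_ ∷ as) = nth n as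

  -- λ_i extended to all integers (λ_i = λ₁ for i ≤ 0, 0 for i > ℓ)
  part : ℤ → ℤ
  part (+ zero)  = + λ₁
  part -[1+ _ ]  = + λ₁
  part (+ suc n) = + nth n p

  -- λ'_j extended to all integers (ℓ for j ≤ 0, 0 for j > λ₁);
  -- for j ≥ 1, λ'_j = max{i : λ_i ≥ j} = #{i : λ_i ≥ j}
  conj : ℤ → ℤ
  conj (+ zero)  = + ℓ
  conj -[1+ _ ]  = + ℓ
  conj (+ suc n) = + length (filter (λ a → suc n ℕ.≤? a) p)

  InDiagram : Sq → Set
  InDiagram (i , j) = (+ 1 ℤ.≤ i) × (i ℤ.≤ + ℓ) × (+ 1 ℤ.≤ j) × (j ℤ.≤ part i)

  IsCorner : Sq → Set
  IsCorner (r , s) = InDiagram (r , s) × ¬ InDiagram (r ℤ.+ + 1 , s)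
                                        × ¬ InDiagram (r , s ℤ.+ + 1)

  IsOuterCorner : Sq → Set
  IsOuterCorner (r , s) = ¬ InDiagram (r , s) × (+ 1 ℤ.≤ r) × (+ 1 ℤ.≤ s)
                        × ((r ≡ + 1) ⊎ InDiagram (r ℤ.- + 1 , s))
                        × ((s ≡ + 1) ⊎ InDiagram (r , s ℤ.- + 1))

  inD : Sq → Bool
  inD (i , j) = (i ≤ᵇ + ℓ) ∧ (j ≤ᵇ part i)

  inD' : Sq → Bool
  inD' (i , j) = (+ 1 ≤ᵇ i) ∧ (+ 1 ≤ᵇ j) ∧ not (j ≤ᵇ part i)

  -- possible moves of the hook walk.  (Squares outside D ∪ D' are given
  -- no moves; they are never corners / outer corners.)
  moves : Sq → List Sq
  moves (i , j) =
    if inD (i , j)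
    then map (λ i' → (i' , j)) (rangeZ (i ℤ.+ + 1) (conj j))
         Data.List.++ map (λ j' → (i , j')) (rangeZ (j ℤ.+ + 1) (part i))
    else if inD' (i , j)
    then map (λ i' → (i' , j)) (rangeZ (conj j ℤ.+ + 1) (i ℤ.- + 1))
         Data.List.++ map (λ j' → (i , j')) (rangeZ (part i ℤ.+ + 1) (j ℤ.- + 1))
    else []

  -- all complete walks (listed by the squares after the start, ending at a
  -- square with no possible move) from a square using at most n moves
  walksN : ℕ → Sq → List (List Sq)
  walksN zero    s = if null (moves s) then ([] ∷ []) else []
  walksN (suc n) s = if null (moves s) then ([] ∷ [])
                     else concatMap (λ t → map (t ∷_) (walksN n t)) (moves s)

  -- a bound on the number of moves of any walk from (i,j) in D ∪ D'
  fuel : Sq → ℕ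
  fuel (i , j) = ∣ i ∣ ℕ.+ ∣ j ∣ ℕ.+ ℓ ℕ.+ λ₁ ℕ.+ 1

  walks : Sq → List (List Sq)
  walks s = walksN (fuel s) s

  endOf : Sq → List Sq → Sq
  endOf s []       = s
  endOf _ (t ∷ ts) = endOf t ts

  rowsOf : Sq → List Sq → List ℤ
  rowsOf s w = map proj₁ (s ∷ w)

  colsOf : Sq → List Sq → List ℤ
  colsOf s w = map proj₂ (s ∷ w)

module Weighted {c ℓF} (F : OrderedField c ℓF) (p : List ℕ)
                (x y : ℤ → OrderedField.Carrier F) where
  open OrderedField F
  open Part p

  Σᶠ : List Carrier → Carrier
  Σᶠ = foldr _+_ 0#

  Πᶠ : List Carrier → Carrier
  Πᶠ = foldr _*_ 1#

  xs : ℤ → ℤ → Carrier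
  xs a b = Σᶠ (map x (rangeZ a b))

  ys : ℤ → ℤ → Carrier
  ys a b = Σᶠ (map y (rangeZ a b))

  norm : Sq → Carrier
  norm (i , j) =
    if inD (i , j) then xs (i ℤ.+ + 1) (conj j) + ys (j ℤ.+ + 1) (part i)
    else xs (conj j ℤ.+ + 1) (i ℤ.- + 1) + ys (part i ℤ.+ + 1) (j ℤ.- + 1)

  stepProb : Sq → Sq → Carrier
  stepProb (i , j) (i' , j') =
    (if i' == i then y j' else x i') * (norm (i , j) ⁻¹)

  walkProb : Sq → List Sq → Carrier
  walkProb s []       = 1#
  walkProb s (t ∷ ts) = stepProb s t * walkProb t ts

  projProb : Sq → List ℤ → List ℤ → Carrier
  projProb s I J = Σᶠ (map (λ w → if sameSet (rowsOf s w) I ∧ sameSet (colsOf s w) J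
                                   then walkProb s w else 0#)
                           (walks s))

  ΠSet : List ℤ → (ℤ → Carrier) → Carrier
  ΠSet l f = Πᶠ (map f (dedup l))

  formulaA : ℤ → ℤ → ℤ → ℤ → List ℤ → List ℤ → Carrier
  formulaA i₁ j₁ r s I J =
    (ΠSet (remove i₁ I) x
      * (ΠSet (remove r I) (λ i → xs (i ℤ.+ + 1) r + ys (s ℤ.+ + 1) (part i)) ⁻¹))
    * (ΠSet (remove j₁ J) y
      * (ΠSet (remove s J) (λ j → xs (r ℤ.+ + 1) (conj j) + ys (j ℤ.+ + 1) s) ⁻¹))

  formulaB : ℤ → ℤ → ℤ → ℤ → List ℤ → List ℤ → Carrier
  formulaB i₁ j₁ r s I J =
    (ΠSet (remove i₁ I) x
      * (ΠSet (remove r I) (λ i → xs r (i ℤ.- + 1) + ys (part i ℤ.+ + 1) (s ℤ.- + 1)) ⁻¹))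
    * (ΠSet (remove j₁ J) y
      * (ΠSet (remove s J) (λ j → xs (conj j ℤ.+ + 1) (r ℤ.- + 1) + ys s (j ℤ.- + 1)) ⁻¹))

module Submission where

-- Fix the end square (r , s) of a walk.  Inside the region D (resp. D')
-- every move strictly increases (resp. decreases) one coordinate, and for
-- squares (i , j) that can still reach (r , s) the normalising constant
-- splits as  norm (i , j) = d i + e j, where d i is the part of the hook
-- sum that lies "before" row r and e j the part before column s.  The
-- probability P(i , j; I , J) that the walk from (i , j) has row set I and
-- column set J then satisfies the recursion
--   P(i , j; I , J) = x i₂ / (d i + e j) · P(i₂ , j; …) + y j₂ / (d i + e j) · P(i , j₂; …),
-- and the product formula  ∏ x / ∏ d · ∏ y / ∏ e  solves it thanks to the
-- partial-fraction identity  (d + e)⁻¹ (d⁻¹ + e⁻¹) = d⁻¹ e⁻¹.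
--
-- The region D with a corner as target, and D' with an
-- outer corner as target, are the two instances giving formulas (a) and
-- (b); lemma2 combines them, using that a walk never leaves its region.

open import Defs
open import Level using (Level)
open import Data.Bool using (Bool; true; false; if_then_else_; _∧_; not)
open import Data.Bool.ListAction using (all)
open import Data.Nat as ℕ using (ℕ; zero; suc; z≤n; s≤s)
import Data.Nat.Properties as ℕP
import Data.Nat.Tactic.RingSolver as ℕSolver
open import Data.Integer as ℤ using (ℤ; +_; -[1+_]; +≤+; _≟_; _≤?_; _≤_; _<_; ∣_∣)
import Data.Integer.Properties as ℤP
open import Data.Integer.Tactic.RingSolver using (solve-∀)
open import Data.List as L using (List; []; _∷_; map; _++_; concatMap; null; filter; length; applyUpTo; upTo)
import Data.List.Properties as LP
open import Data.List.Relation.Unary.All as All using (All; []; _∷_)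
import Data.List.Relation.Unary.All.Properties as AllP
open import Data.List.Relation.Unary.AllPairs as AllPairs using (AllPairs; []; _∷_)
import Data.List.Relation.Unary.AllPairs.Properties as AllPairsP
open import Data.List.Relation.Unary.Any using (here; there)
open import Data.List.Relation.Unary.Linked.Properties using (Linked⇒AllPairs)
open import Data.List.Relation.Unary.Unique.Propositional using (Unique)
open import Data.List.Relation.Unary.Unique.DecPropositional.Properties using (deduplicate-!)
open import Data.List.Membership.Propositional using (_∈_; _∉_)
import Data.List.Membership.Propositional.Properties as ∈P
open import Data.Product using (_×_; _,_; proj₁; proj₂; ∃-syntax)
open import Data.Sum using (_⊎_; inj₁; inj₂)
open import Data.Empty using (⊥-elim)
open import Relation.Nullary using (¬_; Dec; yes; no; ¬?)
open import Relation.Unary using (Pred; Decidable)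
open import Relation.Binary.PropositionalEquality as P using (_≡_; _≢_; refl; cong; cong₂)
open import Relation.Binary.Structures using (IsStrictTotalOrder)
import Relation.Binary.Reasoning.Setoid as SetoidReasoning
import Algebra.Solver.CommutativeMonoid as CMSolver

module OrderedFieldFacts {c ℓ} (F : OrderedField c ℓ) where
  open OrderedField F renaming (_<_ to _<ᶠ_; refl to ≈-refl; sym to ≈-sym; trans to ≈-trans; reflexive to ≈-reflexive)
  open IsStrictTotalOrder isSTO using (irrefl; <-respʳ-≈; <-respˡ-≈) renaming (trans to <-trans)
  open SetoidReasoning setoid public
  private module M = CMSolver *-commutativeMonoid

  Pos : Carrier → Set ℓ
  Pos a = 0# <ᶠ a

  NonNeg : Carrier → Set ℓ
  NonNeg a = Pos a ⊎ (a ≈ 0#)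

  pos-resp : ∀ {a b} → a ≈ b → Pos b → Pos a
  pos-resp e p = <-respʳ-≈ (≈-sym e) p

  pos-+ : ∀ {a b} → Pos a → NonNeg b → Pos (a + b)
  pos-+ {a} {b} pa (inj₂ b≈0) = <-respʳ-≈ (≈-trans (≈-sym (+-identityʳ a)) (+-cong ≈-refl (≈-sym b≈0))) pa
  pos-+ {a} {b} pa (inj₁ pb) =
    <-trans pa (<-respʳ-≈ (+-comm b a) (<-respˡ-≈ (+-identityˡ a) (+-mono-< a pb)))

  nonneg-+-pos : ∀ {a b} → NonNeg a → Pos b → Pos (a + b)
  nonneg-+-pos {a} {b} na pb = pos-resp (+-comm a b) (pos-+ pb na)

  inv-r : ∀ {a} → Pos a → (a * a ⁻¹) ≈ 1#
  inv-r p = ⁻¹-inverse _ (λ a≈0 → irrefl ≈-refl (<-respʳ-≈ a≈0 p))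

  inv-l : ∀ {a} → Pos a → (a ⁻¹ * a) ≈ 1#
  inv-l p = ≈-trans (*-comm _ _) (inv-r p)

  inv-unique : ∀ {a u} → Pos a → (a * u) ≈ 1# → u ≈ a ⁻¹
  inv-unique {a} {u} pa e = begin
    u                 ≈⟨ ≈-sym (*-identityˡ _) ⟩
    1# * u            ≈⟨ *-cong (≈-sym (inv-l pa)) ≈-refl ⟩
    (a ⁻¹ * a) * u    ≈⟨ *-assoc _ _ _ ⟩
    a ⁻¹ * (a * u)    ≈⟨ *-cong ≈-refl e ⟩
    a ⁻¹ * 1#         ≈⟨ *-identityʳ _ ⟩
    a ⁻¹              ∎

  -- The inverse is a total function, so congruence needs positivity.
  inv-cong : ∀ {a b} → Pos a → Pos b → a ≈ b → a ⁻¹ ≈ b ⁻¹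
  inv-cong {a} {b} pa pb e = inv-unique pb (≈-trans (*-cong (≈-sym e) ≈-refl) (inv-r pa))

  inv-* : ∀ {a b} → Pos a → Pos b → (a * b) ⁻¹ ≈ a ⁻¹ * b ⁻¹
  inv-* {a} {b} pa pb = ≈-sym (inv-unique (*-pos pa pb) (begin
    (a * b) * (a ⁻¹ * b ⁻¹)   ≈⟨ interchange a b (a ⁻¹) (b ⁻¹) ⟩
    (a * a ⁻¹) * (b * b ⁻¹)   ≈⟨ *-cong (inv-r pa) (inv-r pb) ⟩
    1# * 1#                   ≈⟨ *-identityˡ _ ⟩
    1#                        ∎))
    where
    interchange : ∀ a b c d → (a * b) * (c * d) ≈ (a * c) * (b * d)
    interchange = M.solve 4 (λ a b c d → ((a M.⊕ b) M.⊕ (c M.⊕ d)) M.⊜ ((a M.⊕ c) M.⊕ (b M.⊕ d))) ≈-refl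

  inv-1 : 1# ⁻¹ ≈ 1#
  inv-1 = ≈-sym (inv-unique 0<1 (*-identityˡ _))

  partial-fraction : ∀ {N d e} → Pos d → Pos e → N ≈ d + e →
                     N ⁻¹ * (e ⁻¹ + d ⁻¹) ≈ d ⁻¹ * e ⁻¹
  partial-fraction {N} {d} {e} pd pe N≈ = begin
      N ⁻¹ * (e ⁻¹ + d ⁻¹)          ≈⟨ *-cong ≈-refl (≈-sym N·de) ⟩
      N ⁻¹ * (N * (d ⁻¹ * e ⁻¹))    ≈⟨ ≈-sym (*-assoc _ _ _) ⟩
      (N ⁻¹ * N) * (d ⁻¹ * e ⁻¹)    ≈⟨ *-cong (inv-l (pos-resp N≈ (pos-+ pd (inj₁ pe)))) ≈-refl ⟩
      1# * (d ⁻¹ * e ⁻¹)            ≈⟨ *-identityˡ _ ⟩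
      d ⁻¹ * e ⁻¹                   ∎
    where
    N·de : N * (d ⁻¹ * e ⁻¹) ≈ e ⁻¹ + d ⁻¹
    N·de = begin
      N * (d ⁻¹ * e ⁻¹)                          ≈⟨ *-cong N≈ ≈-refl ⟩
      (d + e) * (d ⁻¹ * e ⁻¹)                    ≈⟨ distribʳ _ _ _ ⟩
      d * (d ⁻¹ * e ⁻¹) + e * (d ⁻¹ * e ⁻¹)      ≈⟨ +-cong (≈-sym (*-assoc _ _ _)) (rotate e (d ⁻¹) (e ⁻¹)) ⟩
      (d * d ⁻¹) * e ⁻¹ + (e * e ⁻¹) * d ⁻¹      ≈⟨ +-cong (*-cong (inv-r pd) ≈-refl) (*-cong (inv-r pe) ≈-refl) ⟩
      1# * e ⁻¹ + 1# * d ⁻¹                      ≈⟨ +-cong (*-identityˡ _) (*-identityˡ _) ⟩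
      e ⁻¹ + d ⁻¹                                ∎
      where
      rotate : ∀ a u v → a * (u * v) ≈ (a * v) * u
      rotate = M.solve 3 (λ a u v → (a M.⊕ (u M.⊕ v)) M.⊜ ((a M.⊕ v) M.⊕ u)) ≈-refl

  -- One step of the recursion when both a vertical move (weight a, normaliser
  -- share d) and a horizontal move (weight b, share e) are possible: the two
  -- continuations recombine into the product formula.
  close-both : ∀ {a b X Y D E N d e DI EJ} → Pos d → Pos e → Pos D → Pos E → N ≈ d + e →
               DI ≡ d * D → EJ ≡ e * E →
               (a * N ⁻¹) * ((X * D ⁻¹) * ((b * Y) * EJ ⁻¹)) + (b * N ⁻¹) * (((a * X) * DI ⁻¹) * (Y * E ⁻¹))
               ≈ ((a * X) * DI ⁻¹) * ((b * Y) * EJ ⁻¹)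
  close-both {a} {b} {X} {Y} {D} {E} {N} {d} {e} pd pe pD pE N≈ refl refl = begin
      (a * N ⁻¹) * ((X * D ⁻¹) * ((b * Y) * (e * E) ⁻¹)) + (b * N ⁻¹) * (((a * X) * (d * D) ⁻¹) * (Y * E ⁻¹))
        ≈⟨ +-cong (*-cong ≈-refl (*-cong ≈-refl (*-cong ≈-refl (inv-* pe pE))))
                  (*-cong ≈-refl (*-cong (*-cong ≈-refl (inv-* pd pD)) ≈-refl)) ⟩
      (a * N ⁻¹) * ((X * D ⁻¹) * ((b * Y) * (e ⁻¹ * E ⁻¹))) + (b * N ⁻¹) * (((a * X) * (d ⁻¹ * D ⁻¹)) * (Y * E ⁻¹))
        ≈⟨ +-cong (regroup₁ a (N ⁻¹) X (D ⁻¹) b Y (e ⁻¹) (E ⁻¹)) (regroup₂ a (N ⁻¹) X (D ⁻¹) b Y (d ⁻¹) (E ⁻¹)) ⟩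
      (N ⁻¹ * e ⁻¹) * Q + (N ⁻¹ * d ⁻¹) * Q
        ≈⟨ ≈-sym (distribʳ Q _ _) ⟩
      (N ⁻¹ * e ⁻¹ + N ⁻¹ * d ⁻¹) * Q
        ≈⟨ *-cong (≈-sym (distribˡ _ _ _)) ≈-refl ⟩
      (N ⁻¹ * (e ⁻¹ + d ⁻¹)) * Q
        ≈⟨ *-cong (partial-fraction pd pe N≈) ≈-refl ⟩
      (d ⁻¹ * e ⁻¹) * Q
        ≈⟨ regroup₃ a X (D ⁻¹) b Y (d ⁻¹) (e ⁻¹) (E ⁻¹) ⟩
      ((a * X) * (d ⁻¹ * D ⁻¹)) * ((b * Y) * (e ⁻¹ * E ⁻¹))
        ≈⟨ ≈-sym (*-cong (*-cong ≈-refl (inv-* pd pD)) (*-cong ≈-refl (inv-* pe pE))) ⟩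
      ((a * X) * (d * D) ⁻¹) * ((b * Y) * (e * E) ⁻¹) ∎
    where
    Q = ((a * X) * (b * Y)) * (D ⁻¹ * E ⁻¹)
    regroup₁ : ∀ a n X D b Y e E → (a * n) * ((X * D) * ((b * Y) * (e * E))) ≈ (n * e) * (((a * X) * (b * Y)) * (D * E))
    regroup₁ = M.solve 8 (λ a n X D b Y e E →
      ((a M.⊕ n) M.⊕ ((X M.⊕ D) M.⊕ ((b M.⊕ Y) M.⊕ (e M.⊕ E)))) M.⊜ ((n M.⊕ e) M.⊕ (((a M.⊕ X) M.⊕ (b M.⊕ Y)) M.⊕ (D M.⊕ E)))) ≈-refl
    regroup₂ : ∀ a n X D b Y d E → (b * n) * (((a * X) * (d * D)) * (Y * E)) ≈ (n * d) * (((a * X) * (b * Y)) * (D * E))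
    regroup₂ = M.solve 8 (λ a n X D b Y d E →
      ((b M.⊕ n) M.⊕ (((a M.⊕ X) M.⊕ (d M.⊕ D)) M.⊕ (Y M.⊕ E))) M.⊜ ((n M.⊕ d) M.⊕ (((a M.⊕ X) M.⊕ (b M.⊕ Y)) M.⊕ (D M.⊕ E)))) ≈-refl
    regroup₃ : ∀ a X D b Y d e E → (d * e) * (((a * X) * (b * Y)) * (D * E)) ≈ ((a * X) * (d * D)) * ((b * Y) * (e * E))
    regroup₃ = M.solve 8 (λ a X D b Y d e E →
      ((d M.⊕ e) M.⊕ (((a M.⊕ X) M.⊕ (b M.⊕ Y)) M.⊕ (D M.⊕ E))) M.⊜ (((a M.⊕ X) M.⊕ (d M.⊕ D)) M.⊕ ((b M.⊕ Y) M.⊕ (e M.⊕ E)))) ≈-refl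

  -- The same step when only a vertical move is possible (the walk is in column s).
  close-down : ∀ {a X D Z N d DI} → Pos d → Pos D → N ≈ d → DI ≡ d * D →
               (a * N ⁻¹) * ((X * D ⁻¹) * Z) + 0# ≈ ((a * X) * DI ⁻¹) * Z
  close-down {a} {X} {D} {Z} {N} {d} pd pD N≈ refl = begin
    (a * N ⁻¹) * ((X * D ⁻¹) * Z) + 0#   ≈⟨ +-identityʳ _ ⟩
    (a * N ⁻¹) * ((X * D ⁻¹) * Z)        ≈⟨ regroup a (N ⁻¹) X (D ⁻¹) Z ⟩
    ((a * X) * (N ⁻¹ * D ⁻¹)) * Z        ≈⟨ *-cong (*-cong ≈-refl (*-cong (inv-cong (pos-resp N≈ pd) pd N≈) ≈-refl)) ≈-refl ⟩
    ((a * X) * (d ⁻¹ * D ⁻¹)) * Z        ≈⟨ ≈-sym (*-cong (*-cong ≈-refl (inv-* pd pD)) ≈-refl) ⟩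
    ((a * X) * (d * D) ⁻¹) * Z           ∎
    where
    regroup : ∀ a n X D Z → (a * n) * ((X * D) * Z) ≈ ((a * X) * (n * D)) * Z
    regroup = M.solve 5 (λ a n X D Z → ((a M.⊕ n) M.⊕ ((X M.⊕ D) M.⊕ Z)) M.⊜ (((a M.⊕ X) M.⊕ (n M.⊕ D)) M.⊕ Z)) ≈-refl

  -- The same step when only a horizontal move is possible (the walk is in row r).
  close-right : ∀ {b Y E W N e EJ} → Pos e → Pos E → N ≈ e → EJ ≡ e * E →
                0# + (b * N ⁻¹) * (W * (Y * E ⁻¹)) ≈ W * ((b * Y) * EJ ⁻¹)
  close-right {b} {Y} {E} {W} {N} {e} pe pE N≈ refl = begin
    0# + (b * N ⁻¹) * (W * (Y * E ⁻¹))   ≈⟨ +-identityˡ _ ⟩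
    (b * N ⁻¹) * (W * (Y * E ⁻¹))        ≈⟨ regroup b (N ⁻¹) W Y (E ⁻¹) ⟩
    W * ((b * Y) * (N ⁻¹ * E ⁻¹))        ≈⟨ *-cong ≈-refl (*-cong ≈-refl (*-cong (inv-cong (pos-resp N≈ pe) pe N≈) ≈-refl)) ⟩
    W * ((b * Y) * (e ⁻¹ * E ⁻¹))        ≈⟨ ≈-sym (*-cong ≈-refl (*-cong ≈-refl (inv-* pe pE))) ⟩
    W * ((b * Y) * (e * E) ⁻¹)           ∎
    where
    regroup : ∀ b n W Y E → (b * n) * (W * (Y * E)) ≈ W * ((b * Y) * (n * E))
    regroup = M.solve 5 (λ b n W Y E → ((b M.⊕ n) M.⊕ (W M.⊕ (Y M.⊕ E))) M.⊜ (W M.⊕ ((b M.⊕ Y) M.⊕ (n M.⊕ E)))) ≈-refl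

  -- The walk that has already stopped at its end square.
  close-stopped : (1# * 1# ⁻¹) * (1# * 1# ⁻¹) ≈ 1#
  close-stopped = ≈-trans (*-cong (≈-trans (*-identityˡ _) inv-1) (≈-trans (*-identityˡ _) inv-1)) (*-identityˡ _)

  ∑ : List Carrier → Carrier
  ∑ = L.foldr _+_ 0#

  ∑-++ : ∀ l m → ∑ (l ++ m) ≈ ∑ l + ∑ m
  ∑-++ [] m = ≈-sym (+-identityˡ _)
  ∑-++ (a ∷ l) m = ≈-trans (+-cong ≈-refl (∑-++ l m)) (≈-sym (+-assoc _ _ _))

  ∑-map-++ : ∀ {A : Set} (f : A → Carrier) l m → ∑ (map f (l ++ m)) ≈ ∑ (map f l) + ∑ (map f m)
  ∑-map-++ f l m = ≈-trans (≈-reflexive (cong ∑ (LP.map-++ f l m))) (∑-++ (map f l) (map f m))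

  ∑-concatMap : ∀ {A B : Set} (h : B → Carrier) (g : A → List B) l →
                ∑ (map h (concatMap g l)) ≈ ∑ (map (λ t → ∑ (map h (g t))) l)
  ∑-concatMap h g [] = ≈-refl
  ∑-concatMap h g (t ∷ l) = ≈-trans (∑-map-++ h (g t) (concatMap g l)) (+-cong ≈-refl (∑-concatMap h g l))

  ∑-*ˡ : ∀ {A : Set} k (f : A → Carrier) l → k * ∑ (map f l) ≈ ∑ (map (λ a → k * f a) l)
  ∑-*ˡ k f [] = zeroʳ k
  ∑-*ˡ k f (a ∷ l) = ≈-trans (distribˡ _ _ _) (+-cong ≈-refl (∑-*ˡ k f l))

  ∑-cong : ∀ {A : Set} {f g : A → Carrier} {l} → All (λ a → f a ≈ g a) l → ∑ (map f l) ≈ ∑ (map g l)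
  ∑-cong [] = ≈-refl
  ∑-cong (e ∷ es) = +-cong e (∑-cong es)

  ∑-zero : ∀ {A : Set} {f : A → Carrier} l → (∀ {a} → a ∈ l → f a ≈ 0#) → ∑ (map f l) ≈ 0#
  ∑-zero [] h = ≈-refl
  ∑-zero (a ∷ l) h = ≈-trans (+-cong (h (here refl)) (∑-zero l (λ b∈ → h (there b∈)))) (+-identityʳ _)

  ∑-pick : ∀ {A : Set} {f : A → Carrier} {k₀ : A} l → Unique l → k₀ ∈ l →
           (∀ {k} → k ∈ l → k ≢ k₀ → f k ≈ 0#) → ∑ (map f l) ≈ f k₀
  ∑-pick (a ∷ l) (a∉ ∷ u) (here refl) h =
    ≈-trans (+-cong ≈-refl (∑-zero l (λ b∈ → h (there b∈) (λ e → All.lookup a∉ b∈ (P.sym e))))) (+-identityʳ _)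
  ∑-pick (a ∷ l) (a∉ ∷ u) (there k∈) h =
    ≈-trans (+-cong (h (here refl) (λ e → All.lookup a∉ k∈ e)) (∑-pick l u k∈ (λ b∈ → h (there b∈)))) (+-identityˡ _)

  module PositiveWeights (f : ℤ → Carrier) (f-pos : ∀ k → Pos (f k)) where
    sum-nonneg : ∀ l → NonNeg (∑ (map f l))
    sum-nonneg [] = inj₂ ≈-refl
    sum-nonneg (k ∷ l) = inj₁ (pos-+ (f-pos k) (sum-nonneg l))

    sum-pos : ∀ {l k} → k ∈ l → Pos (∑ (map f l))
    sum-pos {k' ∷ l} _ = pos-+ (f-pos k') (sum-nonneg l)

module BooleanReflection where
  if-true : ∀ {a} {A : Set a} {b} {u v : A} → b ≡ true → (if b then u else v) ≡ u
  if-true refl = refl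

  if-false : ∀ {a} {A : Set a} {b} {u v : A} → b ≡ false → (if b then u else v) ≡ v
  if-false refl = refl

  true≢false : true ≢ false
  true≢false ()

  ∧-elim : ∀ {a b} → (a ∧ b) ≡ true → a ≡ true × b ≡ true
  ∧-elim {true} {true} _ = refl , refl

  ∧-intro : ∀ {a b} → a ≡ true → b ≡ true → (a ∧ b) ≡ true
  ∧-intro refl refl = refl

  ∧-falseˡ : ∀ {a b} → ¬ (a ≡ true) → (a ∧ b) ≡ false
  ∧-falseˡ {true} h = ⊥-elim (h refl)
  ∧-falseˡ {false} h = refl

  ∧-falseʳ : ∀ {a b} → ¬ (b ≡ true) → (a ∧ b) ≡ false
  ∧-falseʳ {true} {true} h = ⊥-elim (h refl)
  ∧-falseʳ {true} {false} h = refl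
  ∧-falseʳ {false} h = refl

  not-elim : ∀ {a} → not a ≡ true → a ≡ false
  not-elim {false} _ = refl

  bool-ext : ∀ {a b : Bool} → (a ≡ true → b ≡ true) → (b ≡ true → a ≡ true) → a ≡ b
  bool-ext {true} {true} f g = refl
  bool-ext {true} {false} f g = P.sym (f refl)
  bool-ext {false} {true} f g = g refl
  bool-ext {false} {false} f g = refl

  ==-refl : ∀ a → (a == a) ≡ true
  ==-refl a with a ≟ a
  ... | yes _ = refl
  ... | no a≢a = ⊥-elim (a≢a refl)

  ==-false : ∀ {a b} → a ≢ b → (a == b) ≡ false
  ==-false {a} {b} a≢b with a ≟ b
  ... | yes a≡b = ⊥-elim (a≢b a≡b)
  ... | no _ = refl

  ≤ᵇ-sound : ∀ {a b} → (a ≤ᵇ b) ≡ true → a ≤ b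
  ≤ᵇ-sound {a} {b} e with a ≤? b
  ... | yes a≤b = a≤b

  ≤ᵇ-complete : ∀ {a b} → a ≤ b → (a ≤ᵇ b) ≡ true
  ≤ᵇ-complete {a} {b} a≤b with a ≤? b
  ... | yes _ = refl
  ... | no a≰b = ⊥-elim (a≰b a≤b)

  ≤ᵇ-false : ∀ {a b} → ¬ (a ≤ b) → (a ≤ᵇ b) ≡ false
  ≤ᵇ-false {a} {b} a≰b with a ≤? b
  ... | yes a≤b = ⊥-elim (a≰b a≤b)
  ... | no _ = refl

  ≤ᵇ-false-sound : ∀ {a b} → (a ≤ᵇ b) ≡ false → ¬ (a ≤ b)
  ≤ᵇ-false-sound {a} {b} e a≤b with a ≤? b
  ≤ᵇ-false-sound {a} {b} () a≤b | yes _
  ... | no a≰b = a≰b a≤b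

module SetComparison where
  open BooleanReflection

  _⊆_ : List ℤ → List ℤ → Set
  l ⊆ m = ∀ {a} → a ∈ l → a ∈ m

  _≐_ : List ℤ → List ℤ → Set
  l ≐ m = (l ⊆ m) × (m ⊆ l)

  memb-sound : ∀ {a} l → memb a l ≡ true → a ∈ l
  memb-sound {a} (b ∷ l) e with a ≟ b
  ... | yes a≡b = here a≡b
  ... | no _ = there (memb-sound l e)

  memb-complete : ∀ {a l} → a ∈ l → memb a l ≡ true
  memb-complete {a} {b ∷ l} (here a≡b) with a ≟ b
  ... | yes _ = refl
  ... | no a≢b = ⊥-elim (a≢b a≡b)
  memb-complete {a} {b ∷ l} (there a∈) with a ≟ b
  ... | yes _ = refl
  ... | no _ = memb-complete a∈

  all-sound : ∀ (q : ℤ → Bool) l → all q l ≡ true → ∀ {a} → a ∈ l → q a ≡ true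
  all-sound q (b ∷ l) e (here refl) = proj₁ (∧-elim e)
  all-sound q (b ∷ l) e (there a∈) = all-sound q l (proj₂ (∧-elim e)) a∈

  all-complete : ∀ (q : ℤ → Bool) l → (∀ {a} → a ∈ l → q a ≡ true) → all q l ≡ true
  all-complete q [] h = refl
  all-complete q (b ∷ l) h = ∧-intro (h (here refl)) (all-complete q l (λ a∈ → h (there a∈)))

  sameSet-sound : ∀ l m → sameSet l m ≡ true → l ≐ m
  sameSet-sound l m e = (λ a∈ → memb-sound m (all-sound _ l (proj₁ (∧-elim e)) a∈))
                      , (λ a∈ → memb-sound l (all-sound _ m (proj₂ (∧-elim e)) a∈))

  sameSet-complete : ∀ l m → l ≐ m → sameSet l m ≡ true
  sameSet-complete l m (l⊆m , m⊆l) =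
    ∧-intro (all-complete _ l (λ a∈ → memb-complete (l⊆m a∈))) (all-complete _ m (λ a∈ → memb-complete (m⊆l a∈)))

  sameSet-refl : ∀ l → sameSet l l ≡ true
  sameSet-refl l = sameSet-complete l l ((λ a∈ → a∈) , (λ a∈ → a∈))

  sameSet-≡ : ∀ l m l' m' → (l ≐ m → l' ≐ m') → (l' ≐ m' → l ≐ m) → sameSet l m ≡ sameSet l' m'
  sameSet-≡ l m l' m' f g =
    bool-ext (λ e → sameSet-complete l' m' (f (sameSet-sound l m e)))
             (λ e → sameSet-complete l m (g (sameSet-sound l' m' e)))

  sameSet-cons-cons : ∀ {a L M} → a ∉ L → a ∉ M → sameSet (a ∷ L) (a ∷ M) ≡ sameSet L M
  sameSet-cons-cons {a} {L} {M} a∉L a∉M = sameSet-≡ (a ∷ L) (a ∷ M) L M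
    (λ (h₁ , h₂) → (λ b∈ → strip (h₁ (there b∈)) (λ e → a∉L (P.subst (_∈ L) e b∈)))
                 , (λ b∈ → strip (h₂ (there b∈)) (λ e → a∉M (P.subst (_∈ M) e b∈))))
    (λ (h₁ , h₂) → (λ { (here q) → here q ; (there b∈) → there (h₁ b∈) })
                 , (λ { (here q) → here q ; (there b∈) → there (h₂ b∈) }))
    where
    strip : ∀ {b K} → b ∈ a ∷ K → b ≢ a → b ∈ K
    strip (here q) b≢a = ⊥-elim (b≢a q)
    strip (there b∈) _ = b∈

  sameSet-dup : ∀ {a L M} → a ∈ L → sameSet (a ∷ L) M ≡ sameSet L M
  sameSet-dup {a} {L} {M} a∈L = sameSet-≡ (a ∷ L) M L M
    (λ (h₁ , h₂) → (λ b∈ → h₁ (there b∈)) , (λ b∈ → drop (h₂ b∈)))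
    (λ (h₁ , h₂) → (λ { (here refl) → h₁ a∈L ; (there b∈) → h₁ b∈ }) , (λ b∈ → there (h₂ b∈)))
    where
    drop : ∀ {b} → b ∈ a ∷ L → b ∈ L
    drop (here refl) = a∈L
    drop (there b∈) = b∈

  sameSet-respʳ : ∀ {L M M'} → M ≐ M' → sameSet L M ≡ sameSet L M'
  sameSet-respʳ {L} {M} {M'} (f , g) = sameSet-≡ L M L M'
    (λ (h₁ , h₂) → (λ a∈ → f (h₁ a∈)) , (λ a∈ → h₂ (g a∈)))
    (λ (h₁ , h₂) → (λ a∈ → g (h₁ a∈)) , (λ a∈ → h₂ (f a∈)))

  ≐-dedup : ∀ l → l ≐ dedup l
  ≐-dedup l = ∈P.∈-deduplicate⁺ _≟_ , ∈P.∈-deduplicate⁻ _≟_ l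

module ListRemoval where
  filter-comm : ∀ {U V : Pred ℤ Level.zero} (U? : Decidable U) (V? : Decidable V) L →
                filter U? (filter V? L) ≡ filter V? (filter U? L)
  filter-comm U? V? [] = refl
  filter-comm {U} {V} U? V? (a ∷ L) = by-cases (U? a) (V? a)
    where
    open P.≡-Reasoning
    by-cases : Dec (U a) → Dec (V a) → filter U? (filter V? (a ∷ L)) ≡ filter V? (filter U? (a ∷ L))
    by-cases (yes pa) (yes qa) = begin
      filter U? (filter V? (a ∷ L))   ≡⟨ cong (filter U?) (LP.filter-accept V? qa) ⟩
      filter U? (a ∷ filter V? L)     ≡⟨ LP.filter-accept U? pa ⟩
      a ∷ filter U? (filter V? L)     ≡⟨ cong (a ∷_) (filter-comm U? V? L) ⟩
      a ∷ filter V? (filter U? L)     ≡⟨ P.sym (LP.filter-accept V? qa) ⟩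
      filter V? (a ∷ filter U? L)     ≡⟨ cong (filter V?) (P.sym (LP.filter-accept U? pa)) ⟩
      filter V? (filter U? (a ∷ L))   ∎
    by-cases (yes pa) (no ¬qa) = begin
      filter U? (filter V? (a ∷ L))   ≡⟨ cong (filter U?) (LP.filter-reject V? ¬qa) ⟩
      filter U? (filter V? L)         ≡⟨ filter-comm U? V? L ⟩
      filter V? (filter U? L)         ≡⟨ P.sym (LP.filter-reject V? ¬qa) ⟩
      filter V? (a ∷ filter U? L)     ≡⟨ cong (filter V?) (P.sym (LP.filter-accept U? pa)) ⟩
      filter V? (filter U? (a ∷ L))   ∎
    by-cases (no ¬pa) (yes qa) = begin
      filter U? (filter V? (a ∷ L))   ≡⟨ cong (filter U?) (LP.filter-accept V? qa) ⟩
      filter U? (a ∷ filter V? L)     ≡⟨ LP.filter-reject U? ¬pa ⟩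
      filter U? (filter V? L)         ≡⟨ filter-comm U? V? L ⟩
      filter V? (filter U? L)         ≡⟨ cong (filter V?) (P.sym (LP.filter-reject U? ¬pa)) ⟩
      filter V? (filter U? (a ∷ L))   ∎
    by-cases (no ¬pa) (no ¬qa) = begin
      filter U? (filter V? (a ∷ L))   ≡⟨ cong (filter U?) (LP.filter-reject V? ¬qa) ⟩
      filter U? (filter V? L)         ≡⟨ filter-comm U? V? L ⟩
      filter V? (filter U? L)         ≡⟨ cong (filter V?) (P.sym (LP.filter-reject U? ¬pa)) ⟩
      filter V? (filter U? (a ∷ L))   ∎

  dedup-filter : ∀ {U : Pred ℤ Level.zero} (U? : Decidable U) L → dedup (filter U? L) ≡ filter U? (dedup L)
  dedup-filter U? [] = refl
  dedup-filter {U} U? (a ∷ L) = by-case (U? a)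
    where
    by-case : Dec (U a) → dedup (filter U? (a ∷ L)) ≡ filter U? (dedup (a ∷ L))
    by-case (yes pa) =
      P.trans (cong dedup (LP.filter-accept U? pa))
      (P.trans (cong (λ M → a ∷ filter (λ b → ¬? (a ≟ b)) M) (dedup-filter U? L))
      (P.trans (cong (a ∷_) (filter-comm (λ b → ¬? (a ≟ b)) U? (dedup L)))
               (P.sym (LP.filter-accept U? pa))))
    by-case (no ¬pa) =
      P.trans (cong dedup (LP.filter-reject U? ¬pa))
      (P.trans (dedup-filter U? L)
      (P.sym (P.trans (LP.filter-reject U? ¬pa)
      (P.trans (filter-comm U? (λ b → ¬? (a ≟ b)) (dedup L))
               (LP.filter-all (λ b → ¬? (a ≟ b))
                  (All.map (λ {b} pb e → ¬pa (P.subst U (P.sym e) pb)) (AllP.all-filter U? (dedup L))))))))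

  dedup-remove : ∀ a L → dedup (remove a L) ≡ remove a (dedup L)
  dedup-remove a = dedup-filter (λ z → ¬? (z ≟ a))

  remove-cons : ∀ {a b L} → a ≢ b → remove b (a ∷ L) ≡ a ∷ remove b L
  remove-cons {a} {b} = LP.filter-accept (λ z → ¬? (z ≟ b))

  remove-self : ∀ {b L} → remove b (b ∷ L) ≡ remove b L
  remove-self {b} = LP.filter-reject (λ z → ¬? (z ≟ b)) (λ b≢b → b≢b refl)

  remove-head : ∀ a L → All (a ≢_) L → remove a (a ∷ L) ≡ L
  remove-head a L h = P.trans (remove-self {a} {L}) (LP.filter-all (λ z → ¬? (z ≟ a)) (All.map (λ a≢ q → a≢ (P.sym q)) h))

module IntegerSteps where
  <⇒+1≤ : ∀ {i j} → i < j → i ℤ.+ + 1 ≤ j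
  <⇒+1≤ {i} {j} lt = P.subst (_≤ j) (ℤP.+-comm (+ 1) i) (ℤP.i<j⇒suc[i]≤j lt)

  +1≤⇒< : ∀ {i j} → i ℤ.+ + 1 ≤ j → i < j
  +1≤⇒< {i} {j} le = ℤP.suc[i]≤j⇒i<j (P.subst (_≤ j) (ℤP.+-comm i (+ 1)) le)

  ≤⇒<+1 : ∀ {i j} → i ≤ j → i < j ℤ.+ + 1
  ≤⇒<+1 le = +1≤⇒< (ℤP.+-monoˡ-≤ (+ 1) le)

  ≤-cancelʳ : ∀ {i j} k → i ℤ.+ k ≤ j ℤ.+ k → i ≤ j
  ≤-cancelʳ {i} {j} k h = P.subst₂ _≤_ (undo i k) (undo j k) (ℤP.+-monoˡ-≤ (ℤ.- k) h)
    where
    undo : ∀ a k → (a ℤ.+ k) ℤ.+ ℤ.- k ≡ a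
    undo = solve-∀

  <+1⇒≤ : ∀ {i j} → i < j ℤ.+ + 1 → i ≤ j
  <+1⇒≤ lt = ≤-cancelʳ (+ 1) (<⇒+1≤ lt)

  ≤+1 : ∀ a → a ≤ a ℤ.+ + 1
  ≤+1 a = ℤP.i≤i+j a (+ 1)

  -1+1 : ∀ i → (i ℤ.- + 1) ℤ.+ + 1 ≡ i
  -1+1 = solve-∀

  ≤-1⇒< : ∀ {k i} → k ≤ i ℤ.- + 1 → k < i
  ≤-1⇒< {k} {i} le = +1≤⇒< (P.subst (k ℤ.+ + 1 ≤_) (-1+1 i) (ℤP.+-monoˡ-≤ (+ 1) le))

  <⇒≤-1 : ∀ {k i} → k < i → k ≤ i ℤ.- + 1
  <⇒≤-1 {k} {i} lt = ≤-cancelʳ (+ 1) (P.subst (k ℤ.+ + 1 ≤_) (P.sym (-1+1 i)) (<⇒+1≤ lt))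

  positive? : ∀ j → (+ 1 ≤ j) ⊎ (j ≤ + 0)
  positive? j with + 1 ≤? j
  ... | yes 1≤j = inj₁ 1≤j
  ... | no 1≰j = inj₂ (<+1⇒≤ (ℤP.≰⇒> 1≰j))

  ∣-∣-mono-< : ∀ {u v} → + 0 ≤ u → u < v → ∣ u ∣ ℕ.< ∣ v ∣
  ∣-∣-mono-< {+ a} {+ b} _ (ℤ.+<+ lt) = lt

  ∣-∣-mono-≤ : ∀ {u v} → + 0 ≤ u → u ≤ v → ∣ u ∣ ℕ.≤ ∣ v ∣
  ∣-∣-mono-≤ {+ a} {+ b} _ (+≤+ le) = le

  -- Distances to a target shrink when moving towards it (used to bound the
  -- length of a walk by the fuel of its start).
  dist-towards-above : ∀ {a b c} → a < b → b ≤ c → ∣ c ℤ.- b ∣ ℕ.< ∣ c ℤ.- a ∣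
  dist-towards-above {a} {b} {c} a<b b≤c = ∣-∣-mono-< (ℤP.i≤j⇒0≤j-i b≤c) (ℤP.+-monoʳ-< c (ℤP.neg-mono-< a<b))

  dist-towards-below : ∀ {a b c} → b < a → c ≤ b → ∣ c ℤ.- b ∣ ℕ.< ∣ c ℤ.- a ∣
  dist-towards-below {a} {b} {c} b<a c≤b = P.subst₂ ℕ._<_ (ℤP.∣i-j∣≡∣j-i∣ b c) (ℤP.∣i-j∣≡∣j-i∣ a c)
    (∣-∣-mono-< (ℤP.i≤j⇒0≤j-i c≤b) (ℤP.+-monoˡ-< (ℤ.- c) b<a))

module IntegerRanges where
  open IntegerSteps

  block : ℤ → ℕ → List ℤ
  block a m = applyUpTo (λ k → a ℤ.+ + k) m

  last : ℤ → ℕ → ℤ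
  last a n = a ℤ.+ + n ℤ.- + 1

  private
    shift : ∀ a K → a ℤ.+ (+ 1 ℤ.+ K) ≡ (a ℤ.+ + 1) ℤ.+ K
    shift = solve-∀
    +1-shift : ∀ a K → (a ℤ.+ K) ℤ.+ + 1 ≡ a ℤ.+ (+ 1 ℤ.+ K)
    +1-shift = solve-∀
    last+1 : ∀ a N → (a ℤ.+ N ℤ.- + 1) ℤ.+ + 1 ≡ a ℤ.+ N
    last+1 = solve-∀
    last-0 : ∀ a → a ℤ.+ + 0 ℤ.- + 1 ℤ.+ + 1 ≡ a
    last-0 = solve-∀
    last-suc : ∀ a N → a ℤ.+ (+ 1 ℤ.+ N) ≡ (a ℤ.+ (+ 1 ℤ.+ N) ℤ.- + 1) ℤ.+ + 1
    last-suc = solve-∀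
    length-eq : ∀ a N → (a ℤ.+ (+ 1 ℤ.+ N) ℤ.- + 1) ℤ.- a ≡ N
    length-eq = solve-∀
    last-of : ∀ a B → a ℤ.+ ((B ℤ.+ + 1) ℤ.- a) ℤ.- + 1 ≡ B
    last-of = solve-∀
    last-++ : ∀ a M N → ((a ℤ.+ M ℤ.- + 1) ℤ.+ + 1) ℤ.+ N ℤ.- + 1 ≡ a ℤ.+ (M ℤ.+ N) ℤ.- + 1
    last-++ = solve-∀

  applyUpTo-cong : ∀ {A : Set} {f g : ℕ → A} → (∀ k → f k ≡ g k) → ∀ m → applyUpTo f m ≡ applyUpTo g m
  applyUpTo-cong h zero = refl
  applyUpTo-cong h (suc m) = cong₂ _∷_ (h 0) (applyUpTo-cong (λ k → h (suc k)) m)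

  block-suc : ∀ a m → block a (suc m) ≡ a ∷ block (a ℤ.+ + 1) m
  block-suc a m = cong₂ _∷_ (ℤP.+-identityʳ a) (applyUpTo-cong (λ k → shift a (+ k)) m)

  <+suc : ∀ a m → a < a ℤ.+ + suc m
  <+suc a m = P.subst (a <_) (+1-shift a (+ m)) (≤⇒<+1 (ℤP.i≤i+j a (+ m)))

  block-∈⁻ : ∀ a m {k} → k ∈ block a m → (a ≤ k) × (k < a ℤ.+ + m)
  block-∈⁻ a (suc m) {k} k∈ with P.subst (k ∈_) (block-suc a m) k∈
  ... | here refl = ℤP.≤-refl , <+suc a m
  ... | there k∈' with block-∈⁻ (a ℤ.+ + 1) m k∈'
  ... | lo , hi = ℤP.≤-trans (≤+1 a) lo , P.subst (k <_) (P.sym (shift a (+ m))) hi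

  block-∈⁺ : ∀ a m {k} → a ≤ k → k < a ℤ.+ + m → k ∈ block a m
  block-∈⁺ a zero {k} lo hi = ⊥-elim (ℤP.<⇒≱ hi (P.subst (_≤ k) (P.sym (ℤP.+-identityʳ a)) lo))
  block-∈⁺ a (suc m) {k} lo hi with k ≟ a
  ... | yes refl = P.subst (k ∈_) (P.sym (block-suc a m)) (here refl)
  ... | no k≢a = P.subst (k ∈_) (P.sym (block-suc a m))
                   (there (block-∈⁺ (a ℤ.+ + 1) m (<⇒+1≤ (ℤP.≤∧≢⇒< lo (λ q → k≢a (P.sym q)))) (P.subst (k <_) (shift a (+ m)) hi)))

  block-unique : ∀ a m → Unique (block a m)
  block-unique a zero = []
  block-unique a (suc m) rewrite block-suc a m =
    All.tabulate (λ {k} k∈ q → ℤP.<-irrefl q (+1≤⇒< (proj₁ (block-∈⁻ (a ℤ.+ + 1) m k∈)))) ∷ block-unique (a ℤ.+ + 1) m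

  block-++ : ∀ a m n → block a (m ℕ.+ n) ≡ block a m ++ block (a ℤ.+ + m) n
  block-++ a zero n rewrite ℤP.+-identityʳ a = refl
  block-++ a (suc m) n =
    P.trans (block-suc a (m ℕ.+ n))
    (P.trans (cong (a ∷_) (P.trans (block-++ (a ℤ.+ + 1) m n) (cong (λ z → block (a ℤ.+ + 1) m ++ block z n) (P.sym (shift a (+ m))))))
             (cong (_++ block (a ℤ.+ + suc m) n) (P.sym (block-suc a m))))

  rangeZ-empty : ∀ {a b} → ¬ (a ≤ b) → rangeZ a b ≡ []
  rangeZ-empty {a} {b} a≰b with a ≤? b
  ... | yes a≤b = ⊥-elim (a≰b a≤b)
  ... | no _ = refl

  rangeZ-block : ∀ a n → rangeZ a (last a n) ≡ block a n
  rangeZ-block a zero = rangeZ-empty (λ le → ℤP.<-irrefl refl (ℤP.≤-<-trans le last<a))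
    where
    last<a : last a 0 < a
    last<a = P.subst (last a 0 <_) (last-0 a) (≤⇒<+1 ℤP.≤-refl)
  rangeZ-block a (suc n) with a ≤? last a (suc n)
  ... | no a≰last = ⊥-elim (a≰last (<+1⇒≤ (P.subst (a <_) (last-suc a (+ n)) (<+suc a n))))
  ... | yes _ = P.trans (cong (λ z → map (λ k → a ℤ.+ + k) (upTo (suc z))) (cong ∣_∣ (length-eq a (+ n)))) (LP.map-upTo _ (suc n))

  as-last : ∀ {a b} → a ≤ b ℤ.+ + 1 → ∃[ n ] b ≡ last a n
  as-last {a} {b} le = ∣ (b ℤ.+ + 1) ℤ.- a ∣ ,
    P.sym (P.trans (cong (λ z → a ℤ.+ z ℤ.- + 1) (ℤP.0≤i⇒+∣i∣≡i (ℤP.i≤j⇒0≤j-i le))) (last-of a b))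

  rangeZ-∈⁻ : ∀ {a b k} → k ∈ rangeZ a b → (a ≤ k) × (k ≤ b)
  rangeZ-∈⁻ {a} {b} {k} k∈ with ℤP.≤-total a (b ℤ.+ + 1)
  ... | inj₂ b+1≤a = ⊥-elim (∉[] (P.subst (k ∈_) (rangeZ-empty (λ le → ℤP.<-irrefl refl (ℤP.<-≤-trans (≤⇒<+1 le) b+1≤a))) k∈))
    where
    ∉[] : k ∉ []
    ∉[] ()
  ... | inj₁ le with as-last {a} {b} le
  ... | n , refl with block-∈⁻ a n (P.subst (k ∈_) (rangeZ-block a n) k∈)
  ... | lo , hi = lo , <+1⇒≤ (P.subst (k <_) (P.sym (last+1 a (+ n))) hi)

  rangeZ-∈⁺ : ∀ {a b k} → a ≤ k → k ≤ b → k ∈ rangeZ a b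
  rangeZ-∈⁺ {a} {b} {k} lo hi with as-last {a} {b} (ℤP.≤-trans lo (ℤP.≤-trans hi (≤+1 b)))
  ... | n , refl = P.subst (k ∈_) (P.sym (rangeZ-block a n)) (block-∈⁺ a n lo (P.subst (k <_) (last+1 a (+ n)) (≤⇒<+1 hi)))

  rangeZ-unique : ∀ a b → Unique (rangeZ a b)
  rangeZ-unique a b with ℤP.≤-total a (b ℤ.+ + 1)
  ... | inj₂ b+1≤a = P.subst Unique (P.sym (rangeZ-empty (λ le → ℤP.<-irrefl refl (ℤP.<-≤-trans (≤⇒<+1 le) b+1≤a)))) []
  ... | inj₁ le with as-last {a} {b} le
  ... | n , refl = P.subst Unique (P.sym (rangeZ-block a n)) (block-unique a n)

  rangeZ-++ : ∀ {a b c} → a ≤ b ℤ.+ + 1 → b ≤ c → rangeZ a c ≡ rangeZ a b ++ rangeZ (b ℤ.+ + 1) c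
  rangeZ-++ {a} {b} {c} le₁ le₂ with as-last {a} {b} le₁
  ... | m , refl with as-last {last a m ℤ.+ + 1} {c} (ℤP.+-monoˡ-≤ (+ 1) le₂)
  ... | n , refl =
    P.trans (cong (rangeZ a) (last-++ a (+ m) (+ n)))
    (P.trans (rangeZ-block a (m ℕ.+ n))
    (P.trans (block-++ a m n)
    (cong₂ _++_ (P.sym (rangeZ-block a m))
       (P.trans (P.sym (rangeZ-block (a ℤ.+ + m) n)) (P.sym (cong (λ z → rangeZ z (last z n)) (last+1 a (+ m))))))))

  rangeZ-start : ∀ {a b} → a ≤ b → a ∈ rangeZ a b
  rangeZ-start le = rangeZ-∈⁺ ℤP.≤-refl le


module PartitionFacts (p : List ℕ) (hp : IsPartition p) where
  open Part p

  weakly-decreasing : AllPairs ℕ._≥_ p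
  weakly-decreasing = Linked⇒AllPairs (λ a≥b b≥c → ℕP.≤-trans b≥c a≥b) (proj₂ (proj₂ hp))

  head : List ℕ → ℕ
  head = L.foldr (λ a _ → a) 0

  nth-bounded : ∀ {a} as n → All (a ℕ.≥_) as → nth n as ℕ.≤ a
  nth-bounded [] n h = z≤n
  nth-bounded (b ∷ as) zero (h ∷ _) = h
  nth-bounded (b ∷ as) (suc n) (_ ∷ hs) = nth-bounded as n hs

  nth≤head : ∀ q n → AllPairs ℕ._≥_ q → nth n q ℕ.≤ head q
  nth≤head [] n _ = z≤n
  nth≤head (a ∷ as) zero _ = ℕP.≤-refl
  nth≤head (a ∷ as) (suc n) (h ∷ _) = nth-bounded as n h

  nth-anti : ∀ q {n n'} → AllPairs ℕ._≥_ q → n ℕ.≤ n' → nth n' q ℕ.≤ nth n q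
  nth-anti [] _ _ = z≤n
  nth-anti (a ∷ as) {zero} {n'} ds _ = nth≤head (a ∷ as) n' ds
  nth-anti (a ∷ as) {suc n} {suc n'} (_ ∷ ds) (s≤s le) = nth-anti as ds le

  nth-beyond : ∀ q n → length q ℕ.≤ n → nth n q ≡ 0
  nth-beyond [] n _ = refl
  nth-beyond (a ∷ as) (suc n) (s≤s le) = nth-beyond as n le

  count : ℕ → List ℕ → ℕ
  count c q = length (filter (c ℕ.≤?_) q)

  count-accept : ∀ {c a} as → c ℕ.≤ a → count c (a ∷ as) ≡ suc (count c as)
  count-accept {c} as le = cong length (LP.filter-accept (c ℕ.≤?_) le)

  count-reject : ∀ {c a} as → ¬ (c ℕ.≤ a) → count c (a ∷ as) ≡ count c as
  count-reject {c} as c≰a = cong length (LP.filter-reject (c ℕ.≤?_) c≰a)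

  count-none : ∀ c q → All (ℕ._< c) q → count c q ≡ 0
  count-none c [] [] = refl
  count-none c (a ∷ as) (h ∷ hs) = P.trans (count-reject as (ℕP.<⇒≱ h)) (count-none c as hs)

  count-≥ : ∀ m q n → AllPairs ℕ._≥_ q → suc m ℕ.≤ nth n q → suc n ℕ.≤ count (suc m) q
  count-≥ m [] n _ ()
  count-≥ m (a ∷ as) n (h ∷ ds) le with suc m ℕ.≤? a
  ... | no c≰a = ⊥-elim (c≰a (ℕP.≤-trans le (nth≤head (a ∷ as) n (h ∷ ds))))
  ... | yes c≤a = P.subst (suc n ℕ.≤_) (P.sym (count-accept as c≤a)) (shifted n le)
    where
    shifted : ∀ n → suc m ℕ.≤ nth n (a ∷ as) → suc n ℕ.≤ suc (count (suc m) as)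
    shifted zero _ = s≤s z≤n
    shifted (suc n') le' = s≤s (count-≥ m as n' ds le')

  count-≥⁻ : ∀ m q n → AllPairs ℕ._≥_ q → suc n ℕ.≤ count (suc m) q → suc m ℕ.≤ nth n q
  count-≥⁻ m [] n _ ()
  count-≥⁻ m (a ∷ as) n (h ∷ ds) le with suc m ℕ.≤? a
  ... | yes c≤a = shifted n (P.subst (suc n ℕ.≤_) (count-accept as c≤a) le)
    where
    shifted : ∀ n → suc n ℕ.≤ suc (count (suc m) as) → suc m ℕ.≤ nth n (a ∷ as)
    shifted zero _ = c≤a
    shifted (suc n') le' = count-≥⁻ m as n' ds (ℕP.≤-pred le')
  ... | no c≰a = ⊥-elim (ℕP.<⇒≱ (s≤s z≤n) (P.subst (suc n ℕ.≤_)
          (P.trans (count-reject as c≰a) (count-none (suc m) as (All.map (λ b≤a → ℕP.≤-<-trans b≤a (ℕP.≰⇒> c≰a)) h))) le))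

  count-≤-cons : ∀ c a as → count c as ℕ.≤ count c (a ∷ as)
  count-≤-cons c a as with c ℕ.≤? a
  ... | yes c≤a = P.subst (count c as ℕ.≤_) (P.sym (count-accept as c≤a)) (ℕP.n≤1+n _)
  ... | no c≰a = ℕP.≤-reflexive (P.sym (count-reject as c≰a))

  count-anti : ∀ c c' q → c ℕ.≤ c' → count c' q ℕ.≤ count c q
  count-anti c c' [] _ = z≤n
  count-anti c c' (a ∷ as) le with c' ℕ.≤? a
  ... | yes c'≤a = P.subst₂ ℕ._≤_ (P.sym (count-accept as c'≤a)) (P.sym (count-accept as (ℕP.≤-trans le c'≤a))) (s≤s (count-anti c c' as le))
  ... | no c'≰a = P.subst (ℕ._≤ count c (a ∷ as)) (P.sym (count-reject as c'≰a)) (ℕP.≤-trans (count-anti c c' as le) (count-≤-cons c a as))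

  part-nonneg : ∀ i → + 0 ≤ part i
  part-nonneg (+ zero) = +≤+ z≤n
  part-nonneg (+ suc n) = +≤+ z≤n
  part-nonneg -[1+ _ ] = +≤+ z≤n

  conj-nonneg : ∀ j → + 0 ≤ conj j
  conj-nonneg (+ zero) = +≤+ z≤n
  conj-nonneg (+ suc n) = +≤+ z≤n
  conj-nonneg -[1+ _ ] = +≤+ z≤n

  part≤λ₁ : ∀ i → part i ≤ + λ₁
  part≤λ₁ (+ zero) = ℤP.≤-refl
  part≤λ₁ -[1+ _ ] = ℤP.≤-refl
  part≤λ₁ (+ suc n) = +≤+ (nth≤head p n weakly-decreasing)

  conj≤ℓ : ∀ j → conj j ≤ + ℓ
  conj≤ℓ (+ zero) = ℤP.≤-refl
  conj≤ℓ -[1+ _ ] = ℤP.≤-refl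
  conj≤ℓ (+ suc m) = +≤+ (LP.length-filter (suc m ℕ.≤?_) p)

  part-nonpositive : ∀ {k} → k ≤ + 0 → part k ≡ + λ₁
  part-nonpositive {+ zero} _ = refl
  part-nonpositive { -[1+ _ ]} _ = refl
  part-nonpositive {+ suc n} (+≤+ ())

  conj-nonpositive : ∀ {k} → k ≤ + 0 → conj k ≡ + ℓ
  conj-nonpositive {+ zero} _ = refl
  conj-nonpositive { -[1+ _ ]} _ = refl
  conj-nonpositive {+ suc n} (+≤+ ())

  part-beyond : ∀ i → + ℓ < i → part i ≡ + 0
  part-beyond (+ suc n) (ℤ.+<+ lt) = cong +_ (nth-beyond p n (ℕP.≤-pred lt))
  part-beyond (+ zero) (ℤ.+<+ ())

  ≤part⇒≤conj : ∀ {i j} → + 1 ≤ i → + 1 ≤ j → j ≤ part i → i ≤ conj j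
  ≤part⇒≤conj {+ suc n} {+ suc m} _ _ (+≤+ le) = +≤+ (count-≥ m p n weakly-decreasing le)
  ≤part⇒≤conj {+ zero} (+≤+ ())
  ≤part⇒≤conj {+ suc n} {+ zero} _ (+≤+ ())

  ≤conj⇒≤part : ∀ {i j} → + 1 ≤ i → + 1 ≤ j → i ≤ conj j → j ≤ part i
  ≤conj⇒≤part {+ suc n} {+ suc m} _ _ (+≤+ le) = +≤+ (count-≥⁻ m p n weakly-decreasing le)
  ≤conj⇒≤part {+ zero} (+≤+ ())
  ≤conj⇒≤part {+ suc n} {+ zero} _ (+≤+ ())

  part-anti : ∀ {a b} → a ≤ b → part b ≤ part a
  part-anti {+ zero} {+ zero} _ = ℤP.≤-refl
  part-anti {+ zero} {+ suc n} _ = part≤λ₁ (+ suc n)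
  part-anti { -[1+ _ ]} {+ zero} _ = ℤP.≤-refl
  part-anti { -[1+ _ ]} {+ suc n} _ = part≤λ₁ (+ suc n)
  part-anti { -[1+ _ ]} { -[1+ _ ]} _ = ℤP.≤-refl
  part-anti {+ suc m} {+ suc n} (+≤+ (s≤s le)) = +≤+ (nth-anti p weakly-decreasing le)

  conj-anti : ∀ {a b} → a ≤ b → conj b ≤ conj a
  conj-anti {+ zero} {+ zero} _ = ℤP.≤-refl
  conj-anti {+ zero} {+ suc n} _ = conj≤ℓ (+ suc n)
  conj-anti { -[1+ _ ]} {+ zero} _ = ℤP.≤-refl
  conj-anti { -[1+ _ ]} {+ suc n} _ = conj≤ℓ (+ suc n)
  conj-anti { -[1+ _ ]} { -[1+ _ ]} _ = ℤP.≤-refl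
  conj-anti {+ suc m} {+ suc n} (+≤+ le) = +≤+ (count-anti (suc m) (suc n) p le)

module WalkSums {c ℓF} (F : OrderedField c ℓF) (p : List ℕ) (x y : ℤ → OrderedField.Carrier F) where
  open OrderedField F renaming (refl to ≈-refl; sym to ≈-sym; trans to ≈-trans; reflexive to ≈-reflexive)
  open OrderedFieldFacts F using (∑-concatMap; ∑-cong; ∑-*ˡ)
  open Part p
  open Weighted F p x y

  walkSum : ℕ → Sq → (List Sq → Bool) → Carrier
  walkSum n s P = Σᶠ (map (λ w → if P w then walkProb s w else 0#) (walksN n s))

  private
    if-* : ∀ (b : Bool) k a → (if b then k * a else 0#) ≈ k * (if b then a else 0#)
    if-* true k a = ≈-refl
    if-* false k a = ≈-sym (zeroʳ k)

  walkSum-step : ∀ n s P → null (moves s) ≡ false →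
                 walkSum (suc n) s P ≈ Σᶠ (map (λ t → stepProb s t * walkSum n t (λ w → P (t ∷ w))) (moves s))
  walkSum-step n s P has-move rewrite has-move =
    ≈-trans (∑-concatMap _ (λ t → map (t ∷_) (walksN n t)) (moves s))
            (∑-cong {l = moves s} (All.tabulate (λ {t} _ → after t)))
    where
    after : ∀ t → Σᶠ (map (λ w → if P w then walkProb s w else 0#) (map (t ∷_) (walksN n t)))
                  ≈ stepProb s t * walkSum n t (λ w → P (t ∷ w))
    after t = ≈-trans (≈-reflexive (cong Σᶠ (P.sym (LP.map-∘ (walksN n t)))))
              (≈-trans (∑-cong {l = walksN n t} (All.tabulate (λ {w} _ → if-* (P (t ∷ w)) (stepProb s t) (walkProb t w))))
                       (≈-sym (∑-*ˡ (stepProb s t) _ (walksN n t))))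

  walkSum-stopped : ∀ n s P → null (moves s) ≡ true → walkSum n s P ≈ (if P [] then 1# else 0#)
  walkSum-stopped zero s P no-move rewrite no-move = +-identityʳ _
  walkSum-stopped (suc n) s P no-move rewrite no-move = +-identityʳ _

  walkSum-cong : ∀ n s {P Q} → All (λ w → P w ≡ Q w) (walksN n s) → walkSum n s P ≡ walkSum n s Q
  walkSum-cong n s h = cong Σᶠ (LP.map-cong-local (All.map (λ {w} e → cong (λ b → if b then walkProb s w else 0#) e) h))

  walkSum-none : ∀ n s {P} → All (λ w → P w ≡ false) (walksN n s) → walkSum n s P ≈ 0#
  walkSum-none n s h = ≈-trans (≈-reflexive (walkSum-cong n s h)) (∑-zero-const (walksN n s))
    where
    ∑-zero-const : ∀ ws → Σᶠ (map (λ w → 0#) ws) ≈ 0#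
    ∑-zero-const [] = ≈-refl
    ∑-zero-const (_ ∷ ws) = ≈-trans (+-identityˡ _) (∑-zero-const ws)

-- A monotone region: a set R of squares and a strict order ≺ on ℤ such
-- that from (i , j) ∈ R the walk moves vertically to the rows
-- vsteps (i , j) or horizontally to the columns hsteps (i , j), always
-- ≺-forward and staying in R.  (D with ≺ = <, and D' with ≺ = >.)
module MonotoneRegion {c ℓF} (F : OrderedField c ℓF) (p : List ℕ) (x y : ℤ → OrderedField.Carrier F)
  (_≺_ : ℤ → ℤ → Set) (≺-trans : ∀ {a b c} → a ≺ b → b ≺ c → a ≺ c) (≺-irrefl : ∀ {a} → ¬ (a ≺ a))
  (R : Sq → Set) (vsteps hsteps : Sq → List ℤ)
  (moves-split : ∀ {i j} → R (i , j) →
     Part.moves p (i , j) ≡ map (λ k → (k , j)) (vsteps (i , j)) ++ map (λ k → (i , k)) (hsteps (i , j)))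
  (vsteps-forward : ∀ {i j} → R (i , j) → All (λ k → (i ≺ k) × R (k , j)) (vsteps (i , j)))
  (hsteps-forward : ∀ {i j} → R (i , j) → All (λ k → (j ≺ k) × R (i , k)) (hsteps (i , j)))
  (vsteps-unique : ∀ s → Unique (vsteps s)) (hsteps-unique : ∀ s → Unique (hsteps s))
  where
  open OrderedField F renaming (refl to ≈-refl; sym to ≈-sym; trans to ≈-trans; reflexive to ≈-reflexive)
  open OrderedFieldFacts F
  open BooleanReflection
  open SetComparison
  open ListRemoval
  open Part p
  open Weighted F p x y
  open WalkSums F p x y

  _≼_ : ℤ → ℤ → Set
  a ≼ b = (a ≺ b) ⊎ (a ≡ b)

  ≼-trans : ∀ {a b c} → a ≼ b → b ≼ c → a ≼ c
  ≼-trans (inj₁ a≺b) (inj₁ b≺c) = inj₁ (≺-trans a≺b b≺c)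
  ≼-trans (inj₁ a≺b) (inj₂ refl) = inj₁ a≺b
  ≼-trans (inj₂ refl) b≼c = b≼c

  ≺-≼-trans : ∀ {a b c} → a ≺ b → b ≼ c → a ≺ c
  ≺-≼-trans a≺b (inj₁ b≺c) = ≺-trans a≺b b≺c
  ≺-≼-trans a≺b (inj₂ refl) = a≺b

  ≺⇒≢ : ∀ {a b} → a ≺ b → a ≢ b
  ≺⇒≢ a≺b refl = ≺-irrefl a≺b

  ≺⇒⋡ : ∀ {a b} → a ≺ b → ¬ (b ≼ a)
  ≺⇒⋡ a≺b b≼a = ≺-irrefl (≺-≼-trans a≺b b≼a)

  Chain StrictChain : List ℤ → Set
  Chain = AllPairs _≼_
  StrictChain = AllPairs _≺_

  chain-cons : ∀ {a b L} → a ≼ b → Chain (b ∷ L) → Chain (a ∷ b ∷ L)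
  chain-cons a≼b (h ∷ ch) = (a≼b ∷ All.map (≼-trans a≼b) h) ∷ h ∷ ch

  Monotone : Sq → List Sq → Set
  Monotone s w = R (endOf s w) × Chain (rowsOf s w) × Chain (colsOf s w)

  moves-forward : ∀ {i j} → R (i , j) → All (λ t → R t × (i ≼ proj₁ t) × (j ≼ proj₂ t)) (moves (i , j))
  moves-forward {i} {j} Rij rewrite moves-split Rij =
    AllP.++⁺ (AllP.map⁺ (All.map (λ (i≺k , Rk) → Rk , inj₁ i≺k , inj₂ refl) (vsteps-forward Rij)))
             (AllP.map⁺ (All.map (λ (j≺k , Rk) → Rk , inj₂ refl , inj₁ j≺k) (hsteps-forward Rij)))

  walks-monotone : ∀ n s → R s → All (Monotone s) (walksN n s)
  walks-monotone zero s Rs with null (moves s)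
  ... | true = (Rs , [] ∷ [] , [] ∷ []) ∷ []
  ... | false = []
  walks-monotone (suc n) (i , j) Rs with null (moves (i , j))
  ... | true = (Rs , [] ∷ [] , [] ∷ []) ∷ []
  ... | false = concatMap-all (moves (i , j))
      (All.map (λ {t} (Rt , i≼ , j≼) → AllP.map⁺ (All.map (extend t i≼ j≼) (walks-monotone n t Rt))) (moves-forward Rs))
    where
    extend : ∀ t {w} → i ≼ proj₁ t → j ≼ proj₂ t → Monotone t w → Monotone (i , j) (t ∷ w)
    extend t i≼ j≼ (Rend , rows , cols) = Rend , chain-cons i≼ rows , chain-cons j≼ cols
    concatMap-all : ∀ {A B : Set} {Q : B → Set} {g : A → List B} l → All (λ t → All Q (g t)) l → All Q (concatMap g l)
    concatMap-all [] [] = []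
    concatMap-all (t ∷ l) (h ∷ hs) = AllP.++⁺ h (concatMap-all l hs)

  HasProjections : Sq → List ℤ → List ℤ → List Sq → Bool
  HasProjections s I J w = sameSet (rowsOf s w) I ∧ sameSet (colsOf s w) J

  ∉-ahead : ∀ {i k L} → i ≺ k → All (k ≼_) L → i ∉ k ∷ L
  ∉-ahead i≺k _ (here refl) = ≺-irrefl i≺k
  ∉-ahead i≺k k≼L (there i∈) = ≺⇒⋡ i≺k (All.lookup k≼L i∈)

  ∉-strict : ∀ {i Is} → StrictChain (i ∷ Is) → i ∉ Is
  ∉-strict (h ∷ _) i∈ = ≺-irrefl (All.lookup h i∈)

  next-in-chain : ∀ {i k Is L} → i ≺ k → StrictChain (i ∷ Is) → All (k ≼_) L →
                  sameSet (i ∷ k ∷ L) (i ∷ Is) ≡ true → ∃[ Is' ] Is ≡ k ∷ Is'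
  next-in-chain {i} {k} {Is} {L} i≺k ch k≼L e with sameSet-sound (i ∷ k ∷ L) (i ∷ Is) e
  ... | sub , sup with sub (there (here refl))
  ... | here k≡i = ⊥-elim (≺⇒≢ i≺k (P.sym k≡i))
  ... | there k∈Is = first Is ch k∈Is sup
    where
    first : ∀ Is → StrictChain (i ∷ Is) → k ∈ Is → (i ∷ Is) ⊆ (i ∷ k ∷ L) → ∃[ Is' ] Is ≡ k ∷ Is'
    first (i₂ ∷ Is') _ (here refl) _ = Is' , refl
    first (i₂ ∷ Is') ((i≺i₂ ∷ _) ∷ (i₂≺ ∷ _)) (there k∈) sup with sup (there (here refl))
    ... | here i₂≡i = ⊥-elim (≺⇒≢ i≺i₂ (P.sym i₂≡i))
    ... | there (here i₂≡k) = ⊥-elim (≺⇒≢ (All.lookup i₂≺ k∈) i₂≡k)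
    ... | there (there i₂∈L) = ⊥-elim (≺⇒⋡ (All.lookup i₂≺ k∈) (All.lookup k≼L i₂∈L))

  vertical-mismatch : ∀ n {i j k Is J} → i ≺ k → R (k , j) → StrictChain (i ∷ Is) → (∀ Is' → Is ≢ k ∷ Is') →
                      walkSum n (k , j) (λ w → HasProjections (i , j) (i ∷ Is) J ((k , j) ∷ w)) ≈ 0#
  vertical-mismatch n i≺k Rk ch not-next = walkSum-none n _ (All.map (λ (_ , rows , _) →
    ∧-falseˡ (λ e → let (Is' , q) = next-in-chain i≺k ch (AllPairs.head rows) e in not-next Is' q)) (walks-monotone n _ Rk))

  vertical-match : ∀ n {i j k Is' J} → i ≺ k → R (k , j) → StrictChain (i ∷ k ∷ Is') →
                   walkSum n (k , j) (λ w → HasProjections (i , j) (i ∷ k ∷ Is') J ((k , j) ∷ w))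
                   ≡ walkSum n (k , j) (HasProjections (k , j) (k ∷ Is') J)
  vertical-match n {i} {j} {k} {Is'} {J} i≺k Rk ch = walkSum-cong n _ (All.map (λ {w} (_ , rows , _) →
    cong₂ _∧_ (sameSet-cons-cons (∉-ahead i≺k (AllPairs.head rows)) (∉-strict ch)) (sameSet-dup {j} {j ∷ map proj₂ w} {J} (here refl)))
    (walks-monotone n _ Rk))

  horizontal-mismatch : ∀ n {i j k I Js} → j ≺ k → R (i , k) → StrictChain (j ∷ Js) → (∀ Js' → Js ≢ k ∷ Js') →
                        walkSum n (i , k) (λ w → HasProjections (i , j) I (j ∷ Js) ((i , k) ∷ w)) ≈ 0#
  horizontal-mismatch n {i} {j} {k} {I} j≺k Rk ch not-next = walkSum-none n _ (All.map (λ {w} (_ , _ , cols) →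
    ∧-falseʳ {sameSet (i ∷ i ∷ map proj₁ w) I} (λ e → let (Js' , q) = next-in-chain j≺k ch (AllPairs.head cols) e in not-next Js' q)) (walks-monotone n _ Rk))

  horizontal-match : ∀ n {i j k I Js'} → j ≺ k → R (i , k) → StrictChain (j ∷ k ∷ Js') →
                     walkSum n (i , k) (λ w → HasProjections (i , j) I (j ∷ k ∷ Js') ((i , k) ∷ w))
                     ≡ walkSum n (i , k) (HasProjections (i , k) I (k ∷ Js'))
  horizontal-match n {i} {j} {k} {I} i≺k Rk ch = walkSum-cong n _ (All.map (λ {w} (_ , _ , cols) →
    cong₂ _∧_ (sameSet-dup {i} {i ∷ map proj₁ w} {I} (here refl)) (sameSet-cons-cons (∉-ahead i≺k (AllPairs.head cols)) (∉-strict ch)))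
    (walks-monotone n _ Rk))

  stepProb-vertical : ∀ {i j k} → i ≺ k → stepProb (i , j) (k , j) ≡ x k * norm (i , j) ⁻¹
  stepProb-vertical {i} {j} {k} i≺k rewrite ==-false {k} {i} (λ k≡i → ≺⇒≢ i≺k (P.sym k≡i)) = refl

  stepProb-horizontal : ∀ {i j k} → stepProb (i , j) (i , k) ≡ y k * norm (i , j) ⁻¹
  stepProb-horizontal {i} rewrite ==-refl i = refl

  vertical-term horizontal-term : ℕ → ℤ → ℤ → (List Sq → Bool) → ℤ → Carrier
  vertical-term n i j P k = stepProb (i , j) (k , j) * walkSum n (k , j) (λ w → P ((k , j) ∷ w))
  horizontal-term n i j P k = stepProb (i , j) (i , k) * walkSum n (i , k) (λ w → P ((i , k) ∷ w))

  walkSum-split : ∀ n i j P → R (i , j) → null (moves (i , j)) ≡ false →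
    walkSum (suc n) (i , j) P ≈ Σᶠ (map (vertical-term n i j P) (vsteps (i , j))) + Σᶠ (map (horizontal-term n i j P) (hsteps (i , j)))
  walkSum-split n i j P Rij has-move = begin
    walkSum (suc n) (i , j) P
      ≈⟨ walkSum-step n (i , j) P has-move ⟩
    Σᶠ (map term (moves (i , j)))
      ≡⟨ cong (λ M → Σᶠ (map term M)) (moves-split Rij) ⟩
    Σᶠ (map term (map (λ k → (k , j)) (vsteps (i , j)) ++ map (λ k → (i , k)) (hsteps (i , j))))
      ≈⟨ ∑-map-++ term (map (λ k → (k , j)) (vsteps (i , j))) (map (λ k → (i , k)) (hsteps (i , j))) ⟩
    Σᶠ (map term (map (λ k → (k , j)) (vsteps (i , j)))) + Σᶠ (map term (map (λ k → (i , k)) (hsteps (i , j))))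
      ≡⟨ cong₂ _+_ (cong Σᶠ (P.sym (LP.map-∘ (vsteps (i , j))))) (cong Σᶠ (P.sym (LP.map-∘ (hsteps (i , j))))) ⟩
    Σᶠ (map (vertical-term n i j P) (vsteps (i , j))) + Σᶠ (map (horizontal-term n i j P) (hsteps (i , j))) ∎
    where
    term : Sq → Carrier
    term t = stepProb (i , j) t * walkSum n t (λ w → P (t ∷ w))

  vertical-sum-next : ∀ n {i j k Is' J} → R (i , j) → StrictChain (i ∷ k ∷ Is') → k ∈ vsteps (i , j) →
    Σᶠ (map (vertical-term n i j (HasProjections (i , j) (i ∷ k ∷ Is') J)) (vsteps (i , j)))
    ≈ (x k * norm (i , j) ⁻¹) * walkSum n (k , j) (HasProjections (k , j) (k ∷ Is') J)
  vertical-sum-next n {i} {j} {k} {Is'} {J} Rij ch k∈ =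
    ≈-trans (∑-pick (vsteps (i , j)) (vsteps-unique _) k∈ others-vanish)
            (*-cong (≈-reflexive (stepProb-vertical i≺k)) (≈-reflexive (vertical-match n {J = J} i≺k (proj₂ (All.lookup (vsteps-forward Rij) k∈)) ch)))
    where
    i≺k = All.head (AllPairs.head ch)
    others-vanish : ∀ {k'} → k' ∈ vsteps (i , j) → k' ≢ k → vertical-term n i j (HasProjections (i , j) (i ∷ k ∷ Is') J) k' ≈ 0#
    others-vanish k'∈ k'≢k = let (i≺k' , Rk') = All.lookup (vsteps-forward Rij) k'∈ in
      ≈-trans (*-cong ≈-refl (vertical-mismatch n {J = J} i≺k' Rk' ch (λ _ q → k'≢k (P.sym (LP.∷-injectiveˡ q))))) (zeroʳ _)

  vertical-sum-none : ∀ n {i j J} → R (i , j) →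
    Σᶠ (map (vertical-term n i j (HasProjections (i , j) (i ∷ []) J)) (vsteps (i , j))) ≈ 0#
  vertical-sum-none n {i} {j} {J} Rij = ∑-zero (vsteps (i , j)) (λ k∈ → let (i≺k , Rk) = All.lookup (vsteps-forward Rij) k∈ in
    ≈-trans (*-cong ≈-refl (vertical-mismatch n {J = J} i≺k Rk ([] ∷ []) (λ _ ()))) (zeroʳ _))

  horizontal-sum-next : ∀ n {i j k Js' I} → R (i , j) → StrictChain (j ∷ k ∷ Js') → k ∈ hsteps (i , j) →
    Σᶠ (map (horizontal-term n i j (HasProjections (i , j) I (j ∷ k ∷ Js'))) (hsteps (i , j)))
    ≈ (y k * norm (i , j) ⁻¹) * walkSum n (i , k) (HasProjections (i , k) I (k ∷ Js'))
  horizontal-sum-next n {i} {j} {k} {Js'} {I} Rij ch k∈ =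
    ≈-trans (∑-pick (hsteps (i , j)) (hsteps-unique _) k∈ others-vanish)
            (*-cong (≈-reflexive (stepProb-horizontal {i} {j} {k})) (≈-reflexive (horizontal-match n {I = I} j≺k (proj₂ (All.lookup (hsteps-forward Rij) k∈)) ch)))
    where
    j≺k = All.head (AllPairs.head ch)
    others-vanish : ∀ {k'} → k' ∈ hsteps (i , j) → k' ≢ k → horizontal-term n i j (HasProjections (i , j) I (j ∷ k ∷ Js')) k' ≈ 0#
    others-vanish k'∈ k'≢k = let (j≺k' , Rk') = All.lookup (hsteps-forward Rij) k'∈ in
      ≈-trans (*-cong ≈-refl (horizontal-mismatch n {I = I} j≺k' Rk' ch (λ _ q → k'≢k (P.sym (LP.∷-injectiveˡ q))))) (zeroʳ _)

  horizontal-sum-none : ∀ n {i j I} → R (i , j) →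
    Σᶠ (map (horizontal-term n i j (HasProjections (i , j) I (j ∷ []))) (hsteps (i , j))) ≈ 0#
  horizontal-sum-none n {i} {j} {I} Rij = ∑-zero (hsteps (i , j)) (λ k∈ → let (j≺k , Rk) = All.lookup (hsteps-forward Rij) k∈ in
    ≈-trans (*-cong ≈-refl (horizontal-mismatch n {I = I} j≺k Rk ([] ∷ []) (λ _ ()))) (zeroʳ _))

  has-vertical-move : ∀ {i j k} → R (i , j) → k ∈ vsteps (i , j) → null (moves (i , j)) ≡ false
  has-vertical-move {i} {j} Rij k∈ rewrite moves-split Rij = nonempty k∈
    where
    nonempty : ∀ {k vs} → k ∈ vs → null (map (λ k → (k , j)) vs ++ map (λ k → (i , k)) (hsteps (i , j))) ≡ false
    nonempty (here _) = refl
    nonempty (there _) = refl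

  has-horizontal-move : ∀ {i j k} → R (i , j) → k ∈ hsteps (i , j) → null (moves (i , j)) ≡ false
  has-horizontal-move {i} {j} Rij k∈ rewrite moves-split Rij = nonempty (map (λ k → (k , j)) (vsteps (i , j))) k∈
    where
    nonempty : ∀ {k hs} (vs : List Sq) → k ∈ hs → null (vs ++ map (λ k → (i , k)) hs) ≡ false
    nonempty [] (here _) = refl
    nonempty [] (there _) = refl
    nonempty (_ ∷ _) _ = refl

  product-pos : ∀ (f : ℤ → Carrier) t → (∀ {a} → a ≺ t → Pos (f a)) → ∀ {L} → All (_≼ t) L → Pos (Πᶠ (map f (remove t L)))
  product-pos f t f-pos [] = 0<1
  product-pos f t f-pos {a ∷ L} (inj₁ a≺t ∷ L≼t) rewrite remove-cons {a} {t} {L} (≺⇒≢ a≺t) = *-pos (f-pos a≺t) (product-pos f t f-pos L≼t)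
  product-pos f t f-pos {a ∷ L} (inj₂ refl ∷ L≼t) rewrite remove-self {a} {L} = product-pos f t f-pos L≼t

  head-before : ∀ {t i i₂ Is} → StrictChain (i ∷ i₂ ∷ Is) → All (_≼ t) (i ∷ i₂ ∷ Is) → i ≺ t
  head-before ch (_ ∷ i₂≼t ∷ _) = ≺-≼-trans (All.head (AllPairs.head ch)) i₂≼t

  target-in-rest : ∀ {t i i₂ Is} → StrictChain (i ∷ i₂ ∷ Is) → All (_≼ t) (i ∷ i₂ ∷ Is) → t ∈ i ∷ i₂ ∷ Is → t ∈ i₂ ∷ Is
  target-in-rest ch ≼t (here refl) = ⊥-elim (≺-irrefl (head-before ch ≼t))
  target-in-rest ch ≼t (there t∈) = t∈

  -- Deduplication preserves chains (it keeps first occurrences in order).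
  chain-dedup : ∀ {L} → Chain L → Chain (dedup L)
  chain-dedup {[]} [] = []
  chain-dedup {a ∷ L} (h ∷ ch) =
    AllP.filter⁺ (λ b → ¬? (a ≟ b)) (AllP.deduplicate⁺ _≟_ h) ∷ AllPairsP.filter⁺ (λ b → ¬? (a ≟ b)) (chain-dedup ch)

  strict-dedup : ∀ {L} → Chain L → StrictChain (dedup L)
  strict-dedup {L} ch = AllPairs.zipWith (λ { (inj₁ a≺b , _) → a≺b ; (inj₂ a≡b , a≢b) → ⊥-elim (a≢b a≡b) })
                                         (chain-dedup ch , deduplicate-! _≟_ L)

  end-∈ : ∀ s w → endOf s w ∈ s ∷ w
  end-∈ s [] = here refl
  end-∈ s (t ∷ w) = there (end-∈ t w)

  rows-≼-end : ∀ s w → Chain (rowsOf s w) → All (_≼ proj₁ (endOf s w)) (rowsOf s w)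
  rows-≼-end s [] _ = inj₂ refl ∷ []
  rows-≼-end s (t ∷ w) (h ∷ ch) = All.lookup h (∈P.∈-map⁺ proj₁ (end-∈ t w)) ∷ rows-≼-end t w ch

  cols-≼-end : ∀ s w → Chain (colsOf s w) → All (_≼ proj₂ (endOf s w)) (colsOf s w)
  cols-≼-end s [] _ = inj₂ refl ∷ []
  cols-≼-end s (t ∷ w) (h ∷ ch) = All.lookup h (∈P.∈-map⁺ proj₂ (end-∈ t w)) ∷ cols-≼-end t w ch

  -- The target square (r , s) at which the walk stops, with the splitting
  -- norm (i , j) = d i + e j of the normalisers of squares before it, and a
  -- distance to the target that decreases along ≺ (to bound the walk length).
  module Target (r s : ℤ) (d e : ℤ → Carrier)
    (stops-v : vsteps (r , s) ≡ []) (stops-h : hsteps (r , s) ≡ [])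
    (reach-v : ∀ {i j k} → R (i , j) → j ≼ s → i ≺ k → k ≼ r → k ∈ vsteps (i , j))
    (reach-h : ∀ {i j k} → R (i , j) → i ≼ r → j ≺ k → k ≼ s → k ∈ hsteps (i , j))
    (norm-split : ∀ {i j} → R (i , j) → i ≺ r → j ≺ s → norm (i , j) ≈ d i + e j)
    (norm-row-r : ∀ {j} → R (r , j) → j ≺ s → norm (r , j) ≈ e j)
    (norm-col-s : ∀ {i} → R (i , s) → i ≺ r → norm (i , s) ≈ d i)
    (d-pos : ∀ {i} → i ≺ r → Pos (d i)) (e-pos : ∀ {j} → j ≺ s → Pos (e j))
    (dist : ℤ → ℤ → ℕ) (dist-decreasing : ∀ {a b c} → a ≺ b → b ≼ c → dist c b ℕ.< dist c a)
    where

    weightRatio : List ℤ → List ℤ → List ℤ → List ℤ → Carrier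
    weightRatio A B C D = (Πᶠ (map x A) * Πᶠ (map d B) ⁻¹) * (Πᶠ (map y C) * Πᶠ (map e D) ⁻¹)

    productFormula : ℤ → List ℤ → ℤ → List ℤ → Carrier
    productFormula i Is j Js = weightRatio Is (remove r (i ∷ Is)) Js (remove s (j ∷ Js))

    measure : ℤ → ℤ → ℕ
    measure i j = dist r i ℕ.+ dist s j

    measure-v : ∀ {n i i₂ j} → i ≺ i₂ → i₂ ≼ r → measure i j ℕ.≤ suc n → measure i₂ j ℕ.≤ n
    measure-v {j = j} i≺i₂ i₂≼r bd = ℕP.≤-pred (ℕP.≤-trans (ℕP.+-monoˡ-≤ (dist s j) (dist-decreasing i≺i₂ i₂≼r)) bd)

    measure-h : ∀ {n i j j₂} → j ≺ j₂ → j₂ ≼ s → measure i j ℕ.≤ suc n → measure i j₂ ℕ.≤ n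
    measure-h {i = i} {j₂ = j₂} j≺j₂ j₂≼s bd =
      ℕP.≤-pred (ℕP.≤-trans (ℕP.≤-reflexive (P.sym (ℕP.+-suc (dist r i) (dist s j₂))))
                           (ℕP.≤-trans (ℕP.+-monoʳ-≤ (dist r i) (dist-decreasing j≺j₂ j₂≼s)) bd))

    measure-pos : ∀ {a c} → a ≺ c → 0 ℕ.< dist c a
    measure-pos a≺c = ℕP.≤-trans (s≤s z≤n) (dist-decreasing a≺c (inj₂ refl))

    at-target : ∀ n → R (r , s) → walkSum n (r , s) (HasProjections (r , s) (r ∷ []) (s ∷ [])) ≈ productFormula r [] s []
    at-target n Rrs = begin
      walkSum n (r , s) (HasProjections (r , s) (r ∷ []) (s ∷ []))
        ≈⟨ walkSum-stopped n (r , s) _ stopped ⟩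
      (if HasProjections (r , s) (r ∷ []) (s ∷ []) [] then 1# else 0#)
        ≡⟨ cong (λ b → if b then 1# else 0#) (cong₂ _∧_ (sameSet-refl (r ∷ [])) (sameSet-refl (s ∷ []))) ⟩
      1#
        ≈⟨ ≈-sym close-stopped ⟩
      (1# * 1# ⁻¹) * (1# * 1# ⁻¹)
        ≡⟨ cong₂ (λ A B → (1# * Πᶠ (map d A) ⁻¹) * (1# * Πᶠ (map e B) ⁻¹)) (P.sym (remove-self {r} {[]})) (P.sym (remove-self {s} {[]})) ⟩
      productFormula r [] s [] ∎
      where
      stopped : null (moves (r , s)) ≡ true
      stopped rewrite moves-split Rrs | stops-v | stops-h = refl

    step-vertical : ∀ n {i i₂ Is'} → R (i , s) → StrictChain (i ∷ i₂ ∷ Is') → All (_≼ r) (i ∷ i₂ ∷ Is') →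
      (R (i₂ , s) → walkSum n (i₂ , s) (HasProjections (i₂ , s) (i₂ ∷ Is') (s ∷ [])) ≈ productFormula i₂ Is' s []) →
      walkSum (suc n) (i , s) (HasProjections (i , s) (i ∷ i₂ ∷ Is') (s ∷ [])) ≈ productFormula i (i₂ ∷ Is') s []
    step-vertical n {i} {i₂} {Is'} Ris ch ≼r IH =
      ≈-trans (walkSum-split n i s _ Ris (has-vertical-move Ris i₂∈))
      (≈-trans (+-cong (≈-trans (vertical-sum-next n {J = s ∷ []} Ris ch i₂∈) (*-cong ≈-refl (IH Ri₂))) (horizontal-sum-none n {I = i ∷ i₂ ∷ Is'} Ris))
               (close-down (d-pos i≺r) (product-pos d r d-pos (All.tail ≼r)) (norm-col-s Ris i≺r)
                           (cong (λ M → Πᶠ (map d M)) (remove-cons (≺⇒≢ i≺r)))))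
      where
      i≺r = head-before ch ≼r
      i₂∈ = reach-v Ris (inj₂ refl) (All.head (AllPairs.head ch)) (All.head (All.tail ≼r))
      Ri₂ = proj₂ (All.lookup (vsteps-forward Ris) i₂∈)

    step-horizontal : ∀ n {j j₂ Js'} → R (r , j) → StrictChain (j ∷ j₂ ∷ Js') → All (_≼ s) (j ∷ j₂ ∷ Js') →
      (R (r , j₂) → walkSum n (r , j₂) (HasProjections (r , j₂) (r ∷ []) (j₂ ∷ Js')) ≈ productFormula r [] j₂ Js') →
      walkSum (suc n) (r , j) (HasProjections (r , j) (r ∷ []) (j ∷ j₂ ∷ Js')) ≈ productFormula r [] j (j₂ ∷ Js')
    step-horizontal n {j} {j₂} {Js'} Rrj ch ≼s IH =
      ≈-trans (walkSum-split n r j _ Rrj (has-horizontal-move Rrj j₂∈))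
      (≈-trans (+-cong (vertical-sum-none n {J = j ∷ j₂ ∷ Js'} Rrj) (≈-trans (horizontal-sum-next n {I = r ∷ []} Rrj ch j₂∈) (*-cong ≈-refl (IH Rj₂))))
               (close-right (e-pos j≺s) (product-pos e s e-pos (All.tail ≼s)) (norm-row-r Rrj j≺s)
                            (cong (λ M → Πᶠ (map e M)) (remove-cons (≺⇒≢ j≺s)))))
      where
      j≺s = head-before ch ≼s
      j₂∈ = reach-h Rrj (inj₂ refl) (All.head (AllPairs.head ch)) (All.head (All.tail ≼s))
      Rj₂ = proj₂ (All.lookup (hsteps-forward Rrj) j₂∈)

    -- The generic step: both continuations recombine by the partial-fraction identity.
    step-both : ∀ n {i i₂ Is' j j₂ Js'} → R (i , j) →
      StrictChain (i ∷ i₂ ∷ Is') → All (_≼ r) (i ∷ i₂ ∷ Is') → StrictChain (j ∷ j₂ ∷ Js') → All (_≼ s) (j ∷ j₂ ∷ Js') →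
      (R (i₂ , j) → walkSum n (i₂ , j) (HasProjections (i₂ , j) (i₂ ∷ Is') (j ∷ j₂ ∷ Js')) ≈ productFormula i₂ Is' j (j₂ ∷ Js')) →
      (R (i , j₂) → walkSum n (i , j₂) (HasProjections (i , j₂) (i ∷ i₂ ∷ Is') (j₂ ∷ Js')) ≈ productFormula i (i₂ ∷ Is') j₂ Js') →
      walkSum (suc n) (i , j) (HasProjections (i , j) (i ∷ i₂ ∷ Is') (j ∷ j₂ ∷ Js')) ≈ productFormula i (i₂ ∷ Is') j (j₂ ∷ Js')
    step-both n {i} {i₂} {Is'} {j} {j₂} {Js'} Rij chᵢ ≼r chⱼ ≼s IHᵥ IHₕ =
      ≈-trans (walkSum-split n i j _ Rij (has-vertical-move Rij i₂∈))
      (≈-trans (+-cong (≈-trans (vertical-sum-next n {J = j ∷ j₂ ∷ Js'} Rij chᵢ i₂∈) (*-cong ≈-refl (IHᵥ Ri₂)))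
                       (≈-trans (horizontal-sum-next n {I = i ∷ i₂ ∷ Is'} Rij chⱼ j₂∈) (*-cong ≈-refl (IHₕ Rj₂))))
               (close-both (d-pos i≺r) (e-pos j≺s) (product-pos d r d-pos (All.tail ≼r)) (product-pos e s e-pos (All.tail ≼s))
                           (norm-split Rij i≺r j≺s)
                           (cong (λ M → Πᶠ (map d M)) (remove-cons (≺⇒≢ i≺r))) (cong (λ M → Πᶠ (map e M)) (remove-cons (≺⇒≢ j≺s)))))
      where
      i≺r = head-before chᵢ ≼r
      j≺s = head-before chⱼ ≼s
      i₂∈ = reach-v Rij (inj₁ j≺s) (All.head (AllPairs.head chᵢ)) (All.head (All.tail ≼r))
      j₂∈ = reach-h Rij (inj₁ i≺r) (All.head (AllPairs.head chⱼ)) (All.head (All.tail ≼s))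
      Ri₂ = proj₂ (All.lookup (vsteps-forward Rij) i₂∈)
      Rj₂ = proj₂ (All.lookup (hsteps-forward Rij) j₂∈)

    product-formula : ∀ n i j Is Js → R (i , j) → StrictChain (i ∷ Is) → StrictChain (j ∷ Js) →
      r ∈ i ∷ Is → All (_≼ r) (i ∷ Is) → s ∈ j ∷ Js → All (_≼ s) (j ∷ Js) → measure i j ℕ.≤ n →
      walkSum n (i , j) (HasProjections (i , j) (i ∷ Is) (j ∷ Js)) ≈ productFormula i Is j Js
    product-formula n .r .s [] [] Rrs _ _ (here refl) _ (here refl) _ _ = at-target n Rrs
    product-formula zero i j (i₂ ∷ Is') Js _ chᵢ _ _ ≼r _ _ bd =
      ⊥-elim (ℕP.<⇒≱ (ℕP.≤-trans (measure-pos (head-before chᵢ ≼r)) (ℕP.m≤m+n _ _)) bd)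
    product-formula zero i j [] (j₂ ∷ Js') _ _ chⱼ _ _ _ ≼s bd =
      ⊥-elim (ℕP.<⇒≱ (ℕP.≤-trans (measure-pos (head-before chⱼ ≼s)) (ℕP.m≤n+m _ _)) bd)
    product-formula (suc n) i .s (i₂ ∷ Is') [] Ris chᵢ chⱼ r∈ ≼r (here refl) ≼s bd =
      step-vertical n Ris chᵢ ≼r (λ Ri₂ →
        product-formula n i₂ s Is' [] Ri₂ (AllPairs.tail chᵢ) chⱼ (target-in-rest chᵢ ≼r r∈) (All.tail ≼r) (here refl) ≼s
                        (measure-v (All.head (AllPairs.head chᵢ)) (All.head (All.tail ≼r)) bd))
    product-formula (suc n) .r j [] (j₂ ∷ Js') Rrj chᵢ chⱼ (here refl) ≼r s∈ ≼s bd =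
      step-horizontal n Rrj chⱼ ≼s (λ Rj₂ →
        product-formula n r j₂ [] Js' Rj₂ chᵢ (AllPairs.tail chⱼ) (here refl) ≼r (target-in-rest chⱼ ≼s s∈) (All.tail ≼s)
                        (measure-h (All.head (AllPairs.head chⱼ)) (All.head (All.tail ≼s)) bd))
    product-formula (suc n) i j (i₂ ∷ Is') (j₂ ∷ Js') Rij chᵢ chⱼ r∈ ≼r s∈ ≼s bd =
      step-both n Rij chᵢ ≼r chⱼ ≼s
        (λ Ri₂ → product-formula n i₂ j Is' (j₂ ∷ Js') Ri₂ (AllPairs.tail chᵢ) chⱼ (target-in-rest chᵢ ≼r r∈) (All.tail ≼r) s∈ ≼s
                                 (measure-v (All.head (AllPairs.head chᵢ)) (All.head (All.tail ≼r)) bd))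
        (λ Rj₂ → product-formula n i j₂ (i₂ ∷ Is') Js' Rj₂ chᵢ (AllPairs.tail chⱼ) r∈ ≼r (target-in-rest chⱼ ≼s s∈) (All.tail ≼s)
                                 (measure-h (All.head (AllPairs.head chⱼ)) (All.head (All.tail ≼s)) bd))

    walk-formula : ∀ n i₁ j₁ w → w ∈ walksN n (i₁ , j₁) → R (i₁ , j₁) → endOf (i₁ , j₁) w ≡ (r , s) → measure i₁ j₁ ℕ.≤ n →
      walkSum n (i₁ , j₁) (HasProjections (i₁ , j₁) (rowsOf (i₁ , j₁) w) (colsOf (i₁ , j₁) w))
      ≈ weightRatio (dedup (remove i₁ (rowsOf (i₁ , j₁) w))) (dedup (remove r (rowsOf (i₁ , j₁) w)))
                    (dedup (remove j₁ (colsOf (i₁ , j₁) w))) (dedup (remove s (colsOf (i₁ , j₁) w)))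
    walk-formula n i₁ j₁ w w∈ R₁ end≡ bd = begin
      walkSum n (i₁ , j₁) (HasProjections (i₁ , j₁) I J)
        ≡⟨ walkSum-cong n (i₁ , j₁) (All.tabulate (λ {w'} _ →
             cong₂ _∧_ (sameSet-respʳ {rowsOf (i₁ , j₁) w'} (≐-dedup I)) (sameSet-respʳ {colsOf (i₁ , j₁) w'} (≐-dedup J)))) ⟩
      walkSum n (i₁ , j₁) (HasProjections (i₁ , j₁) (dedup I) (dedup J))
        ≈⟨ product-formula n i₁ j₁ _ _ R₁ (strict-dedup rows) (strict-dedup cols) r∈ ≼r s∈ ≼s bd ⟩
      weightRatio Is (remove r (dedup I)) Js (remove s (dedup J))
        ≡⟨ cong₂ (λ A C → weightRatio A (remove r (dedup I)) C (remove s (dedup J)))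
                 (P.sym (without-start i₁ (map proj₁ w))) (P.sym (without-start j₁ (map proj₂ w))) ⟩
      weightRatio (remove i₁ (dedup I)) (remove r (dedup I)) (remove j₁ (dedup J)) (remove s (dedup J))
        ≡⟨ P.sym (cong₄ (dedup-remove i₁ I) (dedup-remove r I) (dedup-remove j₁ J) (dedup-remove s J)) ⟩
      weightRatio (dedup (remove i₁ I)) (dedup (remove r I)) (dedup (remove j₁ J)) (dedup (remove s J)) ∎
      where
      I = rowsOf (i₁ , j₁) w
      J = colsOf (i₁ , j₁) w
      Is = filter (λ b → ¬? (i₁ ≟ b)) (dedup (map proj₁ w))
      Js = filter (λ b → ¬? (j₁ ≟ b)) (dedup (map proj₂ w))
      monotone = All.lookup (walks-monotone n (i₁ , j₁) R₁) w∈
      rows = proj₁ (proj₂ monotone)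
      cols = proj₂ (proj₂ monotone)
      r∈ : r ∈ dedup I
      r∈ = ∈P.∈-deduplicate⁺ _≟_ (P.subst (_∈ I) (cong proj₁ end≡) (∈P.∈-map⁺ proj₁ (end-∈ (i₁ , j₁) w)))
      s∈ : s ∈ dedup J
      s∈ = ∈P.∈-deduplicate⁺ _≟_ (P.subst (_∈ J) (cong proj₂ end≡) (∈P.∈-map⁺ proj₂ (end-∈ (i₁ , j₁) w)))
      ≼r : All (_≼ r) (dedup I)
      ≼r = AllP.deduplicate⁺ _≟_ (P.subst (λ z → All (_≼ z) I) (cong proj₁ end≡) (rows-≼-end (i₁ , j₁) w rows))
      ≼s : All (_≼ s) (dedup J)
      ≼s = AllP.deduplicate⁺ _≟_ (P.subst (λ z → All (_≼ z) J) (cong proj₂ end≡) (cols-≼-end (i₁ , j₁) w cols))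
      without-start : ∀ a L → remove a (dedup (a ∷ L)) ≡ filter (λ b → ¬? (a ≟ b)) (dedup L)
      without-start a L = remove-head a _ (AllPairs.head (deduplicate-! _≟_ (a ∷ L)))
      cong₄ : ∀ {A A' B B' C C' D D'} → A ≡ A' → B ≡ B' → C ≡ C' → D ≡ D' → weightRatio A B C D ≡ weightRatio A' B' C' D'
      cong₄ refl refl refl refl = refl

module IntervalSums {c ℓF} (F : OrderedField c ℓF) where
  open OrderedField F using (Carrier; _≈_; _+_) renaming (trans to ≈-trans; reflexive to ≈-reflexive)
  open OrderedFieldFacts F using (∑; ∑-map-++)
  open IntegerSteps
  open IntegerRanges

  interval-sum-++ : ∀ (f : ℤ → Carrier) {a b c} → a ≤ b ℤ.+ + 1 → b ≤ c →
                    ∑ (map f (rangeZ a c)) ≈ ∑ (map f (rangeZ a b)) + ∑ (map f (rangeZ (b ℤ.+ + 1) c))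
  interval-sum-++ f {a} {b} {c} a≤b+1 b≤c =
    ≈-trans (≈-reflexive (cong (λ M → ∑ (map f M)) (rangeZ-++ a≤b+1 b≤c))) (∑-map-++ f (rangeZ a b) (rangeZ (b ℤ.+ + 1) c))

  interval-sum-++′ : ∀ (f : ℤ → Carrier) {a t c} → a ≤ t → t ℤ.- + 1 ≤ c →
                     ∑ (map f (rangeZ a c)) ≈ ∑ (map f (rangeZ a (t ℤ.- + 1))) + ∑ (map f (rangeZ t c))
  interval-sum-++′ f {a} {t} {c} a≤t t-1≤c =
    ≈-trans (interval-sum-++ f (P.subst (a ≤_) (P.sym (-1+1 t)) a≤t) t-1≤c)
            (≈-reflexive (cong (λ z → ∑ (map f (rangeZ a (t ℤ.- + 1))) + ∑ (map f (rangeZ z c))) (-1+1 t)))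

module RegionD {c ℓF} (F : OrderedField c ℓF) (p : List ℕ) (hp : IsPartition p)
  (x y : ℤ → OrderedField.Carrier F)
  (x-pos : ∀ i → OrderedField._<_ F (OrderedField.0# F) (x i))
  (y-pos : ∀ j → OrderedField._<_ F (OrderedField.0# F) (y j)) where
  open OrderedField F hiding (_<_; sym) renaming (refl to ≈-refl; trans to ≈-trans; reflexive to ≈-reflexive)
  open OrderedFieldFacts F using (Pos; pos-+; nonneg-+-pos; module PositiveWeights)
  open BooleanReflection
  open IntegerSteps
  open IntegerRanges
  open IntervalSums F
  open PartitionFacts p hp
  open Part p
  open Weighted F p x y
  private
    module X = PositiveWeights x x-pos
    module Y = PositiveWeights y y-pos
    module M = CMSolver +-commutativeMonoid

  InD : Sq → Set
  InD s = inD s ≡ true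

  inD-elim : ∀ {i j} → InD (i , j) → (i ≤ + ℓ) × (j ≤ part i)
  inD-elim h = let (i≤ℓ , j≤λᵢ) = ∧-elim h in ≤ᵇ-sound i≤ℓ , ≤ᵇ-sound j≤λᵢ

  inD-intro : ∀ {i j} → i ≤ + ℓ → j ≤ part i → InD (i , j)
  inD-intro i≤ℓ j≤λᵢ rewrite ≤ᵇ-complete i≤ℓ | ≤ᵇ-complete j≤λᵢ = refl

  vsteps hsteps : Sq → List ℤ
  vsteps (i , j) = rangeZ (i ℤ.+ + 1) (conj j)
  hsteps (i , j) = rangeZ (j ℤ.+ + 1) (part i)

  moves-in-D : ∀ {i j} → InD (i , j) → moves (i , j) ≡ map (λ k → (k , j)) (vsteps (i , j)) ++ map (λ k → (i , k)) (hsteps (i , j))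
  moves-in-D {i} {j} = if-true {b = inD (i , j)}

  norm-in-D : ∀ {i j} → InD (i , j) → norm (i , j) ≡ xs (i ℤ.+ + 1) (conj j) + ys (j ℤ.+ + 1) (part i)
  norm-in-D {i} {j} = if-true {b = inD (i , j)}

  down-closed : ∀ {i j k} → j ≤ part i → i < k → k ≤ conj j → j ≤ part k
  down-closed {i} {j} {k} j≤λᵢ i<k k≤λ'ⱼ with positive? j | positive? k
  ... | inj₂ j≤0 | _ = ℤP.≤-trans j≤0 (part-nonneg k)
  ... | inj₁ 1≤j | inj₁ 1≤k = ≤conj⇒≤part 1≤k 1≤j k≤λ'ⱼ
  ... | inj₁ 1≤j | inj₂ k≤0 = P.subst (j ≤_) (P.sym (part-nonpositive k≤0)) (ℤP.≤-trans j≤λᵢ (part≤λ₁ i))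

  vsteps-forward : ∀ {i j} → InD (i , j) → All (λ k → (i < k) × InD (k , j)) (vsteps (i , j))
  vsteps-forward {i} {j} h = All.tabulate (λ k∈ → let (lo , hi) = rangeZ-∈⁻ {i ℤ.+ + 1} {conj j} k∈ in
    +1≤⇒< lo , inD-intro (ℤP.≤-trans hi (conj≤ℓ j)) (down-closed (proj₂ (inD-elim {i} {j} h)) (+1≤⇒< lo) hi))

  hsteps-forward : ∀ {i j} → InD (i , j) → All (λ k → (j < k) × InD (i , k)) (hsteps (i , j))
  hsteps-forward {i} {j} h = All.tabulate (λ k∈ → let (lo , hi) = rangeZ-∈⁻ {j ℤ.+ + 1} {part i} k∈ in
    +1≤⇒< lo , inD-intro (proj₁ (inD-elim {i} {j} h)) hi)

  module Walk = MonotoneRegion F p x y _<_ ℤP.<-trans (ℤP.<-irrefl refl) InD vsteps hsteps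
                  (λ {i} {j} → moves-in-D {i} {j}) (λ {i} {j} → vsteps-forward {i} {j}) (λ {i} {j} → hsteps-forward {i} {j})
                  (λ (i , j) → rangeZ-unique (i ℤ.+ + 1) (conj j)) (λ (i , j) → rangeZ-unique (j ℤ.+ + 1) (part i))
  open Walk using (_≼_)

  ≼⇒≤ : ∀ {a b} → a ≼ b → a ≤ b
  ≼⇒≤ (inj₁ a<b) = ℤP.<⇒≤ a<b
  ≼⇒≤ (inj₂ refl) = ℤP.≤-refl

  module AtCorner (r s : ℤ) (corner : IsCorner (r , s)) where
    1≤r : + 1 ≤ r
    1≤r = proj₁ (proj₁ corner)
    r≤ℓ : r ≤ + ℓ
    r≤ℓ = proj₁ (proj₂ (proj₁ corner))
    1≤s : + 1 ≤ s
    1≤s = proj₁ (proj₂ (proj₂ (proj₁ corner)))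
    s≤λᵣ : s ≤ part r
    s≤λᵣ = proj₂ (proj₂ (proj₂ (proj₁ corner)))

    part-r : part r ≡ s
    part-r = ℤP.≤-antisym λᵣ≤s s≤λᵣ
      where
      λᵣ≤s : part r ≤ s
      λᵣ≤s with part r ≤? s
      ... | yes λᵣ≤s = λᵣ≤s
      ... | no λᵣ≰s = ⊥-elim (proj₂ (proj₂ corner) (1≤r , r≤ℓ , ℤP.≤-trans 1≤s (≤+1 s) , <⇒+1≤ (ℤP.≰⇒> λᵣ≰s)))

    conj-s : conj s ≡ r
    conj-s = ℤP.≤-antisym λ'ₛ≤r (≤part⇒≤conj 1≤r 1≤s s≤λᵣ)
      where
      λ'ₛ≤r : conj s ≤ r
      λ'ₛ≤r with conj s ≤? r
      ... | yes λ'ₛ≤r = λ'ₛ≤r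
      ... | no λ'ₛ≰r = ⊥-elim (proj₁ (proj₂ corner) (ℤP.≤-trans 1≤r (≤+1 r) , ℤP.≤-trans r+1≤λ'ₛ (conj≤ℓ s) , 1≤s ,
                               ≤conj⇒≤part (ℤP.≤-trans 1≤r (≤+1 r)) 1≤s r+1≤λ'ₛ))
        where
        r+1≤λ'ₛ : r ℤ.+ + 1 ≤ conj s
        r+1≤λ'ₛ = <⇒+1≤ (ℤP.≰⇒> λ'ₛ≰r)

    r≤conj : ∀ {j} → j ≤ s → r ≤ conj j
    r≤conj {j} j≤s with positive? j
    ... | inj₁ 1≤j = ≤part⇒≤conj 1≤r 1≤j (ℤP.≤-trans j≤s s≤λᵣ)
    ... | inj₂ j≤0 = P.subst (r ≤_) (P.sym (conj-nonpositive j≤0)) r≤ℓ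

    -- the shares of the hook sum of (i , j) before row r and before column s
    d e : ℤ → Carrier
    d i = xs (i ℤ.+ + 1) r + ys (s ℤ.+ + 1) (part i)
    e j = xs (r ℤ.+ + 1) (conj j) + ys (j ℤ.+ + 1) s

    norm-split : ∀ {i j} → InD (i , j) → i < r → j < s → norm (i , j) ≈ d i + e j
    norm-split {i} {j} h i<r j<s = ≈-trans (≈-reflexive (norm-in-D {i} {j} h))
      (≈-trans (+-cong (interval-sum-++ x (ℤP.+-monoˡ-≤ (+ 1) (ℤP.<⇒≤ i<r)) (r≤conj (ℤP.<⇒≤ j<s)))
                       (interval-sum-++ y (ℤP.+-monoˡ-≤ (+ 1) (ℤP.<⇒≤ j<s)) (ℤP.≤-trans s≤λᵣ (part-anti (ℤP.<⇒≤ i<r)))))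
               (M.solve 4 (λ a b c d → ((a M.⊕ b) M.⊕ (c M.⊕ d)) M.⊜ ((a M.⊕ d) M.⊕ (b M.⊕ c))) ≈-refl _ _ _ _))

    module T = Walk.Target r s d e
      (rangeZ-empty (λ le → ℤP.<-irrefl refl (ℤP.<-≤-trans (≤⇒<+1 ℤP.≤-refl) (P.subst (r ℤ.+ + 1 ≤_) conj-s le))))
      (rangeZ-empty (λ le → ℤP.<-irrefl refl (ℤP.<-≤-trans (≤⇒<+1 ℤP.≤-refl) (P.subst (s ℤ.+ + 1 ≤_) part-r le))))
      (λ _ j≼s i<k k≼r → rangeZ-∈⁺ (<⇒+1≤ i<k) (ℤP.≤-trans (≼⇒≤ k≼r) (r≤conj (≼⇒≤ j≼s))))
      (λ _ i≼r j<k k≼s → rangeZ-∈⁺ (<⇒+1≤ j<k) (ℤP.≤-trans (≼⇒≤ k≼s) (ℤP.≤-trans s≤λᵣ (part-anti (≼⇒≤ i≼r)))))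
      norm-split
      (λ {j} h _ → ≈-reflexive (P.trans (norm-in-D {r} {j} h) (cong (λ z → xs (r ℤ.+ + 1) (conj j) + ys (j ℤ.+ + 1) z) part-r)))
      (λ {i} h _ → ≈-reflexive (P.trans (norm-in-D {i} {s} h) (cong (λ z → xs (i ℤ.+ + 1) z + ys (s ℤ.+ + 1) (part i)) conj-s)))
      (λ {i} i<r → pos-+ (X.sum-pos (rangeZ-start (<⇒+1≤ i<r))) (Y.sum-nonneg (rangeZ (s ℤ.+ + 1) (part i))))
      (λ {j} j<s → nonneg-+-pos (X.sum-nonneg (rangeZ (r ℤ.+ + 1) (conj j))) (Y.sum-pos (rangeZ-start (<⇒+1≤ j<s))))
      (λ t a → ∣ t ℤ.- a ∣) (λ a<b b≼c → dist-towards-above a<b (≼⇒≤ b≼c))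

    measure≤fuel : ∀ i₁ j₁ → T.measure i₁ j₁ ℕ.≤ fuel (i₁ , j₁)
    measure≤fuel i₁ j₁ =
      ℕP.≤-trans (ℕP.+-mono-≤ (ℕP.≤-trans (ℤP.∣i-j∣≤∣i∣+∣j∣ r i₁) (ℕP.+-monoˡ-≤ ∣ i₁ ∣ ∣r∣≤ℓ))
                              (ℕP.≤-trans (ℤP.∣i-j∣≤∣i∣+∣j∣ s j₁) (ℕP.+-monoˡ-≤ ∣ j₁ ∣ ∣s∣≤λ₁)))
                 (ℕP.≤-trans (ℕP.≤-reflexive (regroup ℓ (∣ i₁ ∣) λ₁ (∣ j₁ ∣))) (ℕP.m≤m+n _ 1))
      where
      ∣r∣≤ℓ : ∣ r ∣ ℕ.≤ ℓ
      ∣r∣≤ℓ = ∣-∣-mono-≤ (ℤP.≤-trans (+≤+ z≤n) 1≤r) r≤ℓ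
      ∣s∣≤λ₁ : ∣ s ∣ ℕ.≤ λ₁
      ∣s∣≤λ₁ = ∣-∣-mono-≤ (ℤP.≤-trans (+≤+ z≤n) 1≤s) (ℤP.≤-trans s≤λᵣ (part≤λ₁ r))
      regroup : ∀ l a m b → (l ℕ.+ a) ℕ.+ (m ℕ.+ b) ≡ ((a ℕ.+ b) ℕ.+ l) ℕ.+ m
      regroup = ℕSolver.solve-∀

    corner-formula : ∀ i₁ j₁ w → w ∈ walks (i₁ , j₁) → InD (i₁ , j₁) → endOf (i₁ , j₁) w ≡ (r , s) →
      projProb (i₁ , j₁) (rowsOf (i₁ , j₁) w) (colsOf (i₁ , j₁) w) ≈ formulaA i₁ j₁ r s (rowsOf (i₁ , j₁) w) (colsOf (i₁ , j₁) w)
    corner-formula i₁ j₁ w w∈ h end≡ = T.walk-formula (fuel (i₁ , j₁)) i₁ j₁ w w∈ h end≡ (measure≤fuel i₁ j₁)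

module RegionD′ {c ℓF} (F : OrderedField c ℓF) (p : List ℕ) (hp : IsPartition p)
  (x y : ℤ → OrderedField.Carrier F)
  (x-pos : ∀ i → OrderedField._<_ F (OrderedField.0# F) (x i))
  (y-pos : ∀ j → OrderedField._<_ F (OrderedField.0# F) (y j)) where
  open OrderedField F hiding (_<_; sym) renaming (refl to ≈-refl; trans to ≈-trans; reflexive to ≈-reflexive)
  open OrderedFieldFacts F using (Pos; pos-+; nonneg-+-pos; module PositiveWeights)
  open BooleanReflection
  open IntegerSteps
  open IntegerRanges
  open IntervalSums F
  open PartitionFacts p hp
  open Part p
  open Weighted F p x y
  private
    module X = PositiveWeights x x-pos
    module Y = PositiveWeights y y-pos
    module M = CMSolver +-commutativeMonoid

  -- In D' the walk moves towards smaller rows and columns.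
  _>_ : ℤ → ℤ → Set
  a > b = b < a

  InD′ : Sq → Set
  InD′ s = inD' s ≡ true

  inD′-elim : ∀ {i j} → InD′ (i , j) → (+ 1 ≤ i) × (+ 1 ≤ j) × ¬ (j ≤ part i)
  inD′-elim h = let (1≤i , rest) = ∧-elim h in let (1≤j , λᵢ<j) = ∧-elim rest in
    ≤ᵇ-sound 1≤i , ≤ᵇ-sound 1≤j , ≤ᵇ-false-sound (not-elim λᵢ<j)

  inD′-intro : ∀ {i j} → + 1 ≤ i → + 1 ≤ j → ¬ (j ≤ part i) → InD′ (i , j)
  inD′-intro 1≤i 1≤j j≰λᵢ rewrite ≤ᵇ-complete 1≤i | ≤ᵇ-complete 1≤j | ≤ᵇ-false j≰λᵢ = refl

  D′-not-D : ∀ {i j} → InD′ (i , j) → inD (i , j) ≡ false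
  D′-not-D {i} {j} h = ∧-falseʳ {i ≤ᵇ + ℓ} (λ e → proj₂ (proj₂ (inD′-elim {i} {j} h)) (≤ᵇ-sound e))

  vsteps hsteps : Sq → List ℤ
  vsteps (i , j) = rangeZ (conj j ℤ.+ + 1) (i ℤ.- + 1)
  hsteps (i , j) = rangeZ (part i ℤ.+ + 1) (j ℤ.- + 1)

  moves-in-D′ : ∀ {i j} → InD′ (i , j) → moves (i , j) ≡ map (λ k → (k , j)) (vsteps (i , j)) ++ map (λ k → (i , k)) (hsteps (i , j))
  moves-in-D′ {i} {j} h = P.trans (if-false {b = inD (i , j)} (D′-not-D {i} {j} h)) (if-true {b = inD' (i , j)} h)

  norm-in-D′ : ∀ {i j} → InD′ (i , j) → norm (i , j) ≡ xs (conj j ℤ.+ + 1) (i ℤ.- + 1) + ys (part i ℤ.+ + 1) (j ℤ.- + 1)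
  norm-in-D′ {i} {j} h = if-false {b = inD (i , j)} (D′-not-D {i} {j} h)

  vsteps-forward : ∀ {i j} → InD′ (i , j) → All (λ k → (i > k) × InD′ (k , j)) (vsteps (i , j))
  vsteps-forward {i} {j} h = All.tabulate (λ {k} k∈ →
    let (lo , hi) = rangeZ-∈⁻ {conj j ℤ.+ + 1} {i ℤ.- + 1} k∈
        (_ , 1≤j , _) = inD′-elim {i} {j} h
        1≤k = ℤP.≤-trans (ℤP.+-monoˡ-≤ (+ 1) (conj-nonneg j)) lo
    in ≤-1⇒< hi , inD′-intro 1≤k 1≤j (λ j≤λₖ → ℤP.<-irrefl refl (ℤP.<-≤-trans (+1≤⇒< lo) (≤part⇒≤conj 1≤k 1≤j j≤λₖ))))

  hsteps-forward : ∀ {i j} → InD′ (i , j) → All (λ k → (j > k) × InD′ (i , k)) (hsteps (i , j))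
  hsteps-forward {i} {j} h = All.tabulate (λ {k} k∈ →
    let (lo , hi) = rangeZ-∈⁻ {part i ℤ.+ + 1} {j ℤ.- + 1} k∈
        (1≤i , _ , _) = inD′-elim {i} {j} h
    in ≤-1⇒< hi , inD′-intro 1≤i (ℤP.≤-trans (ℤP.+-monoˡ-≤ (+ 1) (part-nonneg i)) lo)
                             (λ k≤λᵢ → ℤP.<-irrefl refl (ℤP.<-≤-trans (+1≤⇒< lo) k≤λᵢ)))

  module Walk = MonotoneRegion F p x y _>_ (λ a>b b>c → ℤP.<-trans b>c a>b) (ℤP.<-irrefl refl) InD′ vsteps hsteps
                  (λ {i} {j} → moves-in-D′ {i} {j}) (λ {i} {j} → vsteps-forward {i} {j}) (λ {i} {j} → hsteps-forward {i} {j})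
                  (λ (i , j) → rangeZ-unique (conj j ℤ.+ + 1) (i ℤ.- + 1)) (λ (i , j) → rangeZ-unique (part i ℤ.+ + 1) (j ℤ.- + 1))
  open Walk using (_≼_)

  ≼⇒≥ : ∀ {a b} → a ≼ b → b ≤ a
  ≼⇒≥ (inj₁ a>b) = ℤP.<⇒≤ a>b
  ≼⇒≥ (inj₂ refl) = ℤP.≤-refl

  module AtOuterCorner (r s : ℤ) (outer : IsOuterCorner (r , s)) where
    1≤r : + 1 ≤ r
    1≤r = proj₁ (proj₂ outer)
    1≤s : + 1 ≤ s
    1≤s = proj₁ (proj₂ (proj₂ outer))

    λᵣ<s : ¬ (s ≤ part r)
    λᵣ<s s≤λᵣ with r ≤? + ℓ
    ... | yes r≤ℓ = proj₁ outer (1≤r , r≤ℓ , 1≤s , s≤λᵣ)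
    ... | no r≰ℓ = ℤP.<-irrefl refl (ℤP.<-≤-trans (+1≤⇒< 1≤s) (P.subst (s ≤_) (part-beyond r (ℤP.≰⇒> r≰ℓ)) s≤λᵣ))

    outer-in-D′ : InD′ (r , s)
    outer-in-D′ = inD′-intro 1≤r 1≤s λᵣ<s

    part-r : part r ℤ.+ + 1 ≡ s
    part-r = ℤP.≤-antisym (<⇒+1≤ (ℤP.≰⇒> λᵣ<s)) s≤λᵣ+1
      where
      s≤λᵣ+1 : s ≤ part r ℤ.+ + 1
      s≤λᵣ+1 with proj₂ (proj₂ (proj₂ (proj₂ outer)))
      ... | inj₁ refl = ℤP.+-monoˡ-≤ (+ 1) (part-nonneg r)
      ... | inj₂ (_ , _ , _ , s-1≤λᵣ) = P.subst (_≤ part r ℤ.+ + 1) (-1+1 s) (ℤP.+-monoˡ-≤ (+ 1) s-1≤λᵣ)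

    conj-s : conj s ℤ.+ + 1 ≡ r
    conj-s = ℤP.≤-antisym (<⇒+1≤ λ'ₛ<r) r≤λ'ₛ+1
      where
      λ'ₛ<r : conj s < r
      λ'ₛ<r = ℤP.≰⇒> (λ r≤λ'ₛ → λᵣ<s (≤conj⇒≤part 1≤r 1≤s r≤λ'ₛ))
      r≤λ'ₛ+1 : r ≤ conj s ℤ.+ + 1
      r≤λ'ₛ+1 with proj₁ (proj₂ (proj₂ (proj₂ outer)))
      ... | inj₁ refl = ℤP.+-monoˡ-≤ (+ 1) (conj-nonneg s)
      ... | inj₂ (1≤r-1 , _ , 1≤s′ , s≤λᵣ₋₁) = P.subst (_≤ conj s ℤ.+ + 1) (-1+1 r) (ℤP.+-monoˡ-≤ (+ 1) (≤part⇒≤conj 1≤r-1 1≤s′ s≤λᵣ₋₁))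

    conj+1≤r : ∀ {j} → s ≤ j → conj j ℤ.+ + 1 ≤ r
    conj+1≤r s≤j = P.subst (_ ≤_) conj-s (ℤP.+-monoˡ-≤ (+ 1) (conj-anti s≤j))

    part+1≤s : ∀ {i} → r ≤ i → part i ℤ.+ + 1 ≤ s
    part+1≤s r≤i = P.subst (_ ≤_) part-r (ℤP.+-monoˡ-≤ (+ 1) (part-anti r≤i))

    -- the shares of the hook sum of (i , j) before row r and before column s
    d e : ℤ → Carrier
    d i = xs r (i ℤ.- + 1) + ys (part i ℤ.+ + 1) (s ℤ.- + 1)
    e j = xs (conj j ℤ.+ + 1) (r ℤ.- + 1) + ys s (j ℤ.- + 1)

    norm-split : ∀ {i j} → InD′ (i , j) → i > r → j > s → norm (i , j) ≈ d i + e j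
    norm-split {i} {j} h i>r j>s = ≈-trans (≈-reflexive (norm-in-D′ {i} {j} h))
      (≈-trans (+-cong (interval-sum-++′ x (conj+1≤r (ℤP.<⇒≤ j>s)) (ℤP.+-monoˡ-≤ (ℤ.- + 1) (ℤP.<⇒≤ i>r)))
                       (interval-sum-++′ y (part+1≤s (ℤP.<⇒≤ i>r)) (ℤP.+-monoˡ-≤ (ℤ.- + 1) (ℤP.<⇒≤ j>s))))
               (M.solve 4 (λ a b c d → ((a M.⊕ b) M.⊕ (c M.⊕ d)) M.⊜ ((b M.⊕ c) M.⊕ (a M.⊕ d))) ≈-refl _ _ _ _))

    module T = Walk.Target r s d e
      (rangeZ-empty (λ le → ℤP.<-irrefl refl (≤-1⇒< (P.subst (_≤ r ℤ.- + 1) conj-s le))))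
      (rangeZ-empty (λ le → ℤP.<-irrefl refl (≤-1⇒< (P.subst (_≤ s ℤ.- + 1) part-r le))))
      (λ _ j≼s i>k k≼r → rangeZ-∈⁺ (ℤP.≤-trans (conj+1≤r (≼⇒≥ j≼s)) (≼⇒≥ k≼r)) (<⇒≤-1 i>k))
      (λ _ i≼r j>k k≼s → rangeZ-∈⁺ (ℤP.≤-trans (part+1≤s (≼⇒≥ i≼r)) (≼⇒≥ k≼s)) (<⇒≤-1 j>k))
      norm-split
      (λ {j} h _ → ≈-reflexive (P.trans (norm-in-D′ {r} {j} h) (cong (λ z → xs (conj j ℤ.+ + 1) (r ℤ.- + 1) + ys z (j ℤ.- + 1)) part-r)))
      (λ {i} h _ → ≈-reflexive (P.trans (norm-in-D′ {i} {s} h) (cong (λ z → xs z (i ℤ.- + 1) + ys (part i ℤ.+ + 1) (s ℤ.- + 1)) conj-s)))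
      (λ {i} i>r → pos-+ (X.sum-pos (rangeZ-start (<⇒≤-1 i>r))) (Y.sum-nonneg (rangeZ (part i ℤ.+ + 1) (s ℤ.- + 1))))
      (λ {j} j>s → nonneg-+-pos (X.sum-nonneg (rangeZ (conj j ℤ.+ + 1) (r ℤ.- + 1))) (Y.sum-pos (rangeZ-start (<⇒≤-1 j>s))))
      (λ t a → ∣ t ℤ.- a ∣) (λ a>b b≼c → dist-towards-below a>b (≼⇒≥ b≼c))

    -- Walks in D' only move up and left, so ∣ r - i₁ ∣ ≤ ∣ i₁ ∣ and ∣ s - j₁ ∣ ≤ ∣ j₁ ∣.
    measure≤fuel : ∀ {i₁ j₁} → r ≤ i₁ → s ≤ j₁ → T.measure i₁ j₁ ℕ.≤ fuel (i₁ , j₁)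
    measure≤fuel {i₁} {j₁} r≤i₁ s≤j₁ =
      ℕP.≤-trans (ℕP.+-mono-≤ (dist≤ 1≤r r≤i₁) (dist≤ 1≤s s≤j₁))
                 (ℕP.≤-trans (ℕP.m≤m+n _ _) (ℕP.≤-trans (ℕP.m≤m+n _ _) (ℕP.m≤m+n _ _)))
      where
      dist≤ : ∀ {a b} → + 1 ≤ a → a ≤ b → ∣ a ℤ.- b ∣ ℕ.≤ ∣ b ∣
      dist≤ {a} {b} 1≤a a≤b = P.subst (ℕ._≤ ∣ b ∣) (ℤP.∣i-j∣≡∣j-i∣ b a)
        (∣-∣-mono-≤ (ℤP.i≤j⇒0≤j-i a≤b)
          (P.subst (b ℤ.- a ≤_) (ℤP.+-identityʳ b) (ℤP.+-monoʳ-≤ b (ℤP.neg-mono-≤ (ℤP.≤-trans (+≤+ z≤n) 1≤a)))))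

    outer-corner-formula : ∀ i₁ j₁ w → w ∈ walks (i₁ , j₁) → InD′ (i₁ , j₁) → endOf (i₁ , j₁) w ≡ (r , s) →
      projProb (i₁ , j₁) (rowsOf (i₁ , j₁) w) (colsOf (i₁ , j₁) w) ≈ formulaB i₁ j₁ r s (rowsOf (i₁ , j₁) w) (colsOf (i₁ , j₁) w)
    outer-corner-formula i₁ j₁ w w∈ h end≡ = T.walk-formula (fuel (i₁ , j₁)) i₁ j₁ w w∈ h end≡ (measure≤fuel r≤i₁ s≤j₁)
      where
      monotone = All.lookup (Walk.walks-monotone (fuel (i₁ , j₁)) (i₁ , j₁) h) w∈
      r≤i₁ : r ≤ i₁
      r≤i₁ = ≼⇒≥ (P.subst (i₁ ≼_) (cong proj₁ end≡) (All.head (Walk.rows-≼-end (i₁ , j₁) w (proj₁ (proj₂ monotone)))))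
      s≤j₁ : s ≤ j₁
      s≤j₁ = ≼⇒≥ (P.subst (j₁ ≼_) (cong proj₂ end≡) (All.head (Walk.cols-≼-end (i₁ , j₁) w (proj₂ (proj₂ monotone)))))

-- A walk never leaves the region it starts in; squares outside D ∪ D'
-- have no moves.  Hence a walk ending at a corner starts in D, and one
-- ending at an outer corner starts in D'.
module StartingRegion {c ℓF} (F : OrderedField c ℓF) (p : List ℕ) (hp : IsPartition p)
  (x y : ℤ → OrderedField.Carrier F)
  (x-pos : ∀ i → OrderedField._<_ F (OrderedField.0# F) (x i))
  (y-pos : ∀ j → OrderedField._<_ F (OrderedField.0# F) (y j)) where
  open BooleanReflection
  open Part p
  module D = RegionD F p hp x y x-pos y-pos
  module D′ = RegionD′ F p hp x y x-pos y-pos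

  corner-in-D : ∀ {r s} → IsCorner (r , s) → D.InD (r , s)
  corner-in-D ((_ , r≤ℓ , _ , s≤λᵣ) , _) = D.inD-intro r≤ℓ s≤λᵣ

  outer-corner-in-D′ : ∀ {r s} → IsOuterCorner (r , s) → D′.InD′ (r , s)
  outer-corner-in-D′ {r} {s} = D′.AtOuterCorner.outer-in-D′ r s

  stays-put : ∀ {i j w} → inD (i , j) ≡ false → inD' (i , j) ≡ false → w ∈ walks (i , j) → endOf (i , j) w ≡ (i , j)
  stays-put {i} {j} {w} ∉D ∉D′ w∈ = only-empty (P.subst (w ∈_) (no-walk (fuel (i , j))) w∈)
    where
    no-moves : moves (i , j) ≡ []
    no-moves = P.trans (if-false {b = inD (i , j)} ∉D) (if-false {b = inD' (i , j)} ∉D′)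
    no-walk : ∀ n → walksN n (i , j) ≡ [] ∷ []
    no-walk zero rewrite no-moves = refl
    no-walk (suc n) rewrite no-moves = refl
    only-empty : w ∈ [] ∷ [] → endOf (i , j) w ≡ (i , j)
    only-empty (here refl) = refl

  D-D′-disjoint : ∀ t → D.InD t → ¬ D′.InD′ t
  D-D′-disjoint (a , b) ∈D ∈D′ = true≢false (P.trans (P.sym ∈D) (D′.D′-not-D {a} {b} ∈D′))

  end-in-D : ∀ {t w} → D.InD t → w ∈ walks t → D.InD (endOf t w)
  end-in-D {t} ∈D w∈ = proj₁ (All.lookup (D.Walk.walks-monotone (fuel t) t ∈D) w∈)

  end-in-D′ : ∀ {t w} → D′.InD′ t → w ∈ walks t → D′.InD′ (endOf t w)
  end-in-D′ {t} ∈D′ w∈ = proj₁ (All.lookup (D′.Walk.walks-monotone (fuel t) t ∈D′) w∈)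

  corner-start : ∀ {i j w} → w ∈ walks (i , j) → IsCorner (endOf (i , j) w) → D.InD (i , j)
  corner-start {i} {j} {w} w∈ corner with inD (i , j) in ∈D | inD' (i , j) in ∈D′
  ... | true | _ = refl
  ... | false | true = ⊥-elim (D-D′-disjoint (endOf (i , j) w) (corner-in-D corner) (end-in-D′ ∈D′ w∈))
  ... | false | false = ⊥-elim (true≢false (P.trans (P.sym (P.subst D.InD (stays-put ∈D ∈D′ w∈) (corner-in-D corner))) ∈D))

  outer-start : ∀ {i j w} → w ∈ walks (i , j) → IsOuterCorner (endOf (i , j) w) → D′.InD′ (i , j)
  outer-start {i} {j} {w} w∈ outer with inD (i , j) in ∈D | inD' (i , j) in ∈D′
  ... | true | _ = ⊥-elim (D-D′-disjoint (endOf (i , j) w) (end-in-D ∈D w∈) (outer-corner-in-D′ outer))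
  ... | false | true = refl
  ... | false | false = ⊥-elim (true≢false (P.trans (P.sym (P.subst D′.InD′ (stays-put ∈D ∈D′ w∈) (outer-corner-in-D′ outer))) ∈D′))

lemma2 : ∀ {c ℓ : Level} (F : OrderedField c ℓ) (p : List ℕ) → IsPartition p →
         (x y : ℤ → OrderedField.Carrier F) →
         (∀ i → OrderedField._<_ F (OrderedField.0# F) (x i)) →
         (∀ j → OrderedField._<_ F (OrderedField.0# F) (y j)) →
         (i₁ j₁ : ℤ) (w : List Sq) → w ∈ Part.walks p (i₁ , j₁) →
         let r = Data.Product.proj₁ (Part.endOf p (i₁ , j₁) w)
             s = Data.Product.proj₂ (Part.endOf p (i₁ , j₁) w)
             I = Part.rowsOf p (i₁ , j₁) w
             J = Part.colsOf p (i₁ , j₁) w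
         in (Part.IsCorner p (r , s) →
               OrderedField._≈_ F (Weighted.projProb F p x y (i₁ , j₁) I J)
                                  (Weighted.formulaA F p x y i₁ j₁ r s I J))
          × (Part.IsOuterCorner p (r , s) →
               OrderedField._≈_ F (Weighted.projProb F p x y (i₁ , j₁) I J)
                                  (Weighted.formulaB F p x y i₁ j₁ r s I J))
lemma2 F p hp x y x-pos y-pos i₁ j₁ w w∈ =
    (λ corner → D.AtCorner.corner-formula r s corner i₁ j₁ w w∈ (corner-start w∈ corner) refl)
  , (λ outer → D′.AtOuterCorner.outer-corner-formula r s outer i₁ j₁ w w∈ (outer-start w∈ outer) refl)
  where
  open StartingRegion F p hp x y x-pos y-pos
  r = proj₁ (Part.endOf p (i₁ , j₁) w)
  s = proj₂ (Part.endOf p (i₁ , j₁) w)
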